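{- Fix $i_0\in I$. The functions $\{\check{\mathtt{c}}_F: F\in\Sigma_{i_0}[I]\}$ on adjoint chambers are linearly independent.
   Context: Let $\mathbb{k}$ be a field of characteristic zero and $I$ a nonempty finite set. $\mathrm{T}^\vee_I=\{h\in\mathbb{R}I:\sum_ih_i=0\}$, and the adjoint braid arrangement consists of the hyperplanes $\{h:\sum_{i\in S}h_i=0\}$ for $\emptyset\ne S\subsetneq I$; its chambers are the adjoint chambers. For a composition $F$ of $I$ (ordered tuple of nonempty disjoint lumps with union $I$), $\sigma^\vee_F$ is the cone generated by the vectors $e_{i_1}-e_{i_2}$ with the lump of $i_1$ weakly left of that of $i_2$ (a permutohedral tangent cone), and $\check{\mathtt{c}}_F$ is the $\mathbb{k}$-valued function on adjoint chambers equal to $1$ on chambers contained in $\sigma^\vee_F$ and $0$ otherwise. $\Sigma_{i_0}[I]$ is the set of compositions of $I$ whose first lump contains $i_0$. -}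

module Defs where

open import Level using (Level; _⊔_; suc)
open import Algebra.Bundles using (CommutativeRing)
open import Data.Nat as ℕ using (ℕ; zero; suc)
open import Data.Fin as Fin using (Fin; toℕ)
open import Data.Fin.Subset using (Subset; _∈_; Nonempty; _⊂_; ⊤)
open import Data.Vec using (Vec; []; _∷_; lookup)
import Data.Vec.Membership.Propositional as VecMem
open import Data.Bool using (Bool; true; false; if_then_else_)
open import Data.Rational as ℚ using (ℚ; 0ℚ; _<_; _≤_)
open import Data.Product using (Σ; _×_; _,_; proj₁; proj₂; ∃)
open import Data.List using (List; []; _∷_)
open import Relation.Nullary using (¬_)
open import Relation.Binary.PropositionalEquality using (_≡_)

natCast : ∀ {c ℓ} (R : CommutativeRing c ℓ) → ℕ → CommutativeRing.Carrier R
natCast R zero    = CommutativeRing.0# R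
natCast R (suc n) = CommutativeRing._+_ R (CommutativeRing.1# R) (natCast R n)

record CharZeroField (c ℓ : Level) : Set (Level.suc (c ⊔ ℓ)) where
  field
    commRing : CommutativeRing c ℓ
  open CommutativeRing commRing public
  field
    1≉0      : ¬ (1# ≈ 0#)
    inverse  : ∀ x → ¬ (x ≈ 0#) → Σ Carrier λ y → (x * y) ≈ 1#
    charZero : ∀ n → natCast commRing n ≈ 0# → n ≡ 0

-- The ground set I = Fin n.  Vectors in ℝI are modelled by rational
-- vectors h : Fin n → ℚ (every open adjoint chamber is determined by,
-- and contains, rational points; the cones σ^∨_F are rational).

Σall : ∀ {n} → (Fin n → ℚ) → ℚ
Σall {zero}  h = 0ℚ
Σall {suc n} h = h Fin.zero ℚ.+ Σall (λ i → h (Fin.suc i))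

ΣS : ∀ {n} → Subset n → (Fin n → ℚ) → ℚ
ΣS {zero}  []      h = 0ℚ
ΣS {suc n} (b ∷ S) h =
  (if b then h Fin.zero else 0ℚ) ℚ.+ ΣS S (λ i → h (Fin.suc i))

InT : ∀ {n} → (Fin n → ℚ) → Set
InT h = Σall h ≡ 0ℚ

-- proper nonempty subsets S (∅ ≠ S ⊊ I): these index the adjoint hyperplanes
ProperNonempty : ∀ {n} → Subset n → Set
ProperNonempty S = Nonempty S × (S ⊂ ⊤)

Generic : ∀ {n} → (Fin n → ℚ) → Set
Generic h = InT h × (∀ S → ProperNonempty S → ¬ (ΣS S h ≡ 0ℚ))

-- Adjoint chambers, each represented by a generic point it contains.
record Chamber (n : ℕ) : Set where
  constructor chamber
  field
    point   : Fin n → ℚ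
    generic : Generic point

InChamber : ∀ {n} → Chamber n → (Fin n → ℚ) → Set
InChamber {n} C h' =
  Generic h' ×
  (∀ S → ProperNonempty S →
     (0ℚ < ΣS S (Chamber.point C) → 0ℚ < ΣS S h') ×
     (0ℚ < ΣS S h' → 0ℚ < ΣS S (Chamber.point C)))

-- Compositions of I = Fin n: a number k of lumps and the lump-assignment
-- i ↦ index of the lump containing i, which must be surjective
-- (lumps nonempty).  Lump order = order of Fin k.

record Composition (n : ℕ) : Set where
  constructor composition
  field
    k    : ℕ
    lump : Vec (Fin k) n
    surj : ∀ (j : Fin k) → j VecMem.∈ lump

SameComp : ∀ {n} → Composition n → Composition n → Set
SameComp F G =
  Σ (Composition.k F ≡ Composition.k G) λ where
    _≡_.refl → Composition.lump F ≡ Composition.lump G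

FirstLumpContains : ∀ {n} → Fin n → Composition n → Set
FirstLumpContains i0 F = toℕ (lookup (Composition.lump F) i0) ≡ 0

WeaklyLeft : ∀ {n} → Composition n → Fin n → Fin n → Set
WeaklyLeft F i1 i2 =
  toℕ (lookup (Composition.lump F) i1) ℕ.≤ toℕ (lookup (Composition.lump F) i2)

-- h ∈ σ^∨_F: h is a nonnegative combination  Σ λ_{i1 i2} (e_{i1} - e_{i2})
-- over the pairs with i1's lump weakly left of i2's lump.
InCone : ∀ {n} → Composition n → (Fin n → ℚ) → Set
InCone {n} F h =
  Σ (Fin n → Fin n → ℚ) λ λ' →
    (∀ i1 i2 → 0ℚ ≤ λ' i1 i2) ×
    (∀ i1 i2 → ¬ WeaklyLeft F i1 i2 → λ' i1 i2 ≡ 0ℚ) ×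
    (∀ m → h m ≡ Σall (λ j → λ' m j) ℚ.- Σall (λ i → λ' i m))

ChamberInCone : ∀ {n} → Chamber n → Composition n → Set
ChamberInCone C F = ∀ h' → InChamber C h' → InCone F h'

module _ {c ℓ} (K : CharZeroField c ℓ) where
  open CharZeroField K

  IsCheckC : ∀ {n} → (Composition n → Chamber n → Carrier) → Set ℓ
  IsCheckC {n} cc =
    ∀ (F : Composition n) (C : Chamber n) →
      (ChamberInCone C F → cc F C ≈ 1#) ×
      (¬ ChamberInCone C F → cc F C ≈ 0#)

  linComb : ∀ {n} → (Composition n → Chamber n → Carrier) →
            List (Composition n × Carrier) → Chamber n → Carrier
  linComb cc []             C = 0#
  linComb cc ((F , a) ∷ L)  C = (a * cc F C) + linComb cc L C

-- For F ∈ Σ_{i0}[I], order I by an injective κ that ranks earlier lumps of F higher. For a set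
-- P ⊆ I, the point h with h_j = −2^{κ j} on P and +2^{κ j} off P, corrected at i0 so that Σ h = 0,
-- is generic: a coordinate sum over a set avoiding i0 has the sign of its κ-largest element. As
-- σ^∨_G is cut out by the inequalities "sum over the lumps 0, …, p of G ≥ 0", the chamber of h lies
-- in σ^∨_G iff for every cut p of G the κ-largest element after p lies in P. So a vanishing
-- combination Σ a_G č_G gives, for every P, that the a_G with all cut tops of G in P sum to 0, and
-- inclusion–exclusion over the cut tops of F shows that the a_G with the same cut tops as F sum to 0.
-- Any such G ≠ F has smaller rank (more lumps, or lumps moved left), so a_F = 0 by induction on
-- the rank.
module Submission where

open import Defs
open import Algebra.Bundles using (CommutativeMonoid)
open import Data.Nat using (ℕ)
open import Data.Fin using (Fin)
open import Data.Product using (_×_; proj₁; proj₂)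
open import Data.List using (List)
open import Data.List.Relation.Unary.All using (All)
import Data.List.Relation.Unary.All as All
open import Data.List.Relation.Unary.AllPairs using (AllPairs)
open import Relation.Nullary using (¬_)

module BooleanTests where
  open import Data.Nat using (zero; suc; _≡ᵇ_; _≤ᵇ_; _<ᵇ_)
  open import Data.Nat.Properties using (≡ᵇ⇒≡)
  open import Data.Fin using (Fin; zero; suc)
  open import Data.Bool using (Bool; true; false; T)
  open import Relation.Binary.PropositionalEquality

  ≡true⇒T : ∀ {b} → b ≡ true → T b
  ≡true⇒T refl = _

  infix 4 _==_
  _==_ : ∀ {n} → Fin n → Fin n → Bool
  zero  == zero  = true
  zero  == suc _ = false
  suc _ == zero  = false
  suc i == suc j = i == j

  ==-refl : ∀ {n} (i : Fin n) → (i == i) ≡ true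
  ==-refl zero    = refl
  ==-refl (suc i) = ==-refl i

  ==⇒≡ : ∀ {n} (i j : Fin n) → (i == j) ≡ true → i ≡ j
  ==⇒≡ zero    zero    _  = refl
  ==⇒≡ (suc i) (suc j) eq = cong suc (==⇒≡ i j eq)

  ≡ᵇ-sym : ∀ a b → (a ≡ᵇ b) ≡ (b ≡ᵇ a)
  ≡ᵇ-sym zero    zero    = refl
  ≡ᵇ-sym zero    (suc b) = refl
  ≡ᵇ-sym (suc a) zero    = refl
  ≡ᵇ-sym (suc a) (suc b) = ≡ᵇ-sym a b

  ≡ᵇ-true⇒≡ : ∀ {a b} → (a ≡ᵇ b) ≡ true → a ≡ b
  ≡ᵇ-true⇒≡ {a} {b} eq = ≡ᵇ⇒≡ a b (≡true⇒T eq)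

  ≡⇒≡ᵇ-true : ∀ {a b} → a ≡ b → (a ≡ᵇ b) ≡ true
  ≡⇒≡ᵇ-true {zero}  refl = refl
  ≡⇒≡ᵇ-true {suc a} refl = ≡⇒≡ᵇ-true {a} refl

  <ᵇ-suc : ∀ a q → (a <ᵇ suc q) ≡ (a ≤ᵇ q)
  <ᵇ-suc zero    q = refl
  <ᵇ-suc (suc a) q = refl

module BoundedQuantifiers where
  open import Data.Nat using (ℕ; zero; suc; _<_; _≟_; _∸_; s≤s)
  open import Data.Nat.Properties using (≤-refl; ≤-pred; m≤n⇒m≤1+n; ≤∧≢⇒<)
  open import Data.Bool using (Bool; true; false; _∧_; _∨_; not)
  open import Data.Bool.Properties using (∧-zeroʳ; ∨-zeroʳ)
  open import Data.Product using (Σ; _×_; _,_)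
  open import Relation.Binary.PropositionalEquality
  open import Relation.Nullary using (yes; no)
  open import Data.List using (map; downFrom)
  open import Data.Bool.ListAction using (all)

  allBelow anyBelow : ℕ → (ℕ → Bool) → Bool
  allBelow zero    f = true
  allBelow (suc m) f = f m ∧ allBelow m f
  anyBelow zero    f = false
  anyBelow (suc m) f = f m ∨ anyBelow m f

  allBelow⁻ : ∀ m f → allBelow m f ≡ true → ∀ p → p < m → f p ≡ true
  allBelow⁻ (suc m) f eq p p<1+m with f m in fm | allBelow m f in rest
  allBelow⁻ (suc m) f eq p p<1+m | true | true with p ≟ m
  ... | yes refl = fm
  ... | no  p≢m  = allBelow⁻ m f rest p (≤∧≢⇒< (≤-pred p<1+m) p≢m)

  allBelow⁺ : ∀ m f → (∀ p → p < m → f p ≡ true) → allBelow m f ≡ true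
  allBelow⁺ zero    f holds = refl
  allBelow⁺ (suc m) f holds rewrite holds m ≤-refl = allBelow⁺ m f (λ p p<m → holds p (m≤n⇒m≤1+n p<m))

  allBelow-false : ∀ m f → allBelow m f ≡ false → Σ ℕ λ p → p < m × f p ≡ false
  allBelow-false (suc m) f eq with f m in fm
  ... | false = m , ≤-refl , fm
  ... | true  with allBelow-false m f eq
  ...   | p , p<m , fp = p , m≤n⇒m≤1+n p<m , fp

  allBelow-cong : ∀ m {f g : ℕ → Bool} → (∀ p → f p ≡ g p) → allBelow m f ≡ allBelow m g
  allBelow-cong zero    f≗g = refl
  allBelow-cong (suc m) f≗g = cong₂ _∧_ (f≗g m) (allBelow-cong m f≗g)

  anyBelow⁻ : ∀ m f → anyBelow m f ≡ true → Σ ℕ λ p → p < m × f p ≡ true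
  anyBelow⁻ (suc m) f eq with f m in fm
  ... | true  = m , ≤-refl , fm
  ... | false with anyBelow⁻ m f eq
  ...   | p , p<m , fp = p , m≤n⇒m≤1+n p<m , fp

  anyBelow⁺ : ∀ m f p → p < m → f p ≡ true → anyBelow m f ≡ true
  anyBelow⁺ (suc m) f p p<1+m fp with p ≟ m
  ... | yes refl rewrite fp = refl
  ... | no  p≢m  rewrite anyBelow⁺ m f p (≤∧≢⇒< (≤-pred p<1+m) p≢m) fp = ∨-zeroʳ (f m)

  allBelow-∧-not : ∀ m (f g : ℕ → Bool) →
    allBelow m (λ p → f p ∧ not (g p)) ≡ not (anyBelow m g) ∧ allBelow m f
  allBelow-∧-not zero    f g = refl
  allBelow-∧-not (suc m) f g rewrite allBelow-∧-not m f g with f m | g m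
  ... | true  | true  = refl
  ... | true  | false = refl
  ... | false | true  = refl
  ... | false | false = sym (∧-zeroʳ (not (anyBelow m g)))

  <∸1⇒suc< : ∀ {p m} → p < m ∸ 1 → suc p < m
  <∸1⇒suc< {m = suc m} p<m = s≤s p<m

  suc<⇒<∸1 : ∀ {p m} → suc p < m → p < m ∸ 1
  suc<⇒<∸1 {m = suc m} (s≤s p<m) = p<m

  all-map-downFrom : ∀ {A : Set} m (f : ℕ → A) (g : A → Bool) →
                     all g (map f (downFrom m)) ≡ allBelow m (λ p → g (f p))
  all-map-downFrom zero    f g = refl
  all-map-downFrom (suc m) f g = cong (g (f m) ∧_) (all-map-downFrom m f g)

module IncreasingSequences where
  open import Data.Nat using (ℕ; zero; suc; _+_; _∸_; _≤_; _<_; s≤s; z≤n)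
  open import Data.Nat.Properties
  open import Relation.Binary.PropositionalEquality

  module _ (K : ℕ) (a : ℕ → ℕ) (increasing : ∀ q → suc (suc q) < K → a q < a (suc q)) where
    a-+ : ∀ q r → suc (q + r) < K → a q + r ≤ a (q + r)
    a-+ q zero    _ rewrite +-identityʳ q | +-identityʳ (a q) = ≤-refl
    a-+ q (suc r) 2+q+r<K rewrite +-suc q r | +-suc (a q) r =
      <-≤-trans (s≤s (a-+ q r (<-trans (n<1+n _) 2+q+r<K))) (increasing (q + r) 2+q+r<K)

    increasing⇒index≤ : (1 < K → 0 < a 0) → ∀ q → suc q < K → suc q ≤ a q
    increasing⇒index≤ a0>0 q 1+q<K =
      ≤-trans (+-monoˡ-≤ q (a0>0 (≤-<-trans (s≤s z≤n) 1+q<K))) (a-+ 0 q 1+q<K)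

    increasing⇒≤index : (∀ q → suc q < K → a q < K) → ∀ q → suc q < K → a q ≤ suc q
    increasing⇒≤index a<K q 1+q<K = <⇒≤pred (+-cancelʳ-< r (a q) (suc (suc q)) (begin-strict
      a q + r          ≤⟨ a-+ q r 1+q+r<K ⟩
      a (q + r)        <⟨ a<K (q + r) 1+q+r<K ⟩
      K                ≡⟨ sym (m+[n∸m]≡n 1+q<K) ⟩
      suc (suc q) + r  ∎))
      where
      open ≤-Reasoning
      r = K ∸ suc (suc q)
      1+q+r<K : suc (q + r) < K
      1+q+r<K = subst (suc (q + r) <_) (m+[n∸m]≡n 1+q<K) (n<1+n _)

module FinSum where
  open import Data.Nat using (zero; suc)
  open import Data.Fin using (Fin; zero; suc)
  open import Data.Bool using (Bool; true; false; if_then_else_; not; _∧_)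
  open import Data.Vec using ([]; _∷_; lookup)
  open import Data.Fin.Subset using (Subset)
  open import Data.Rational using (ℚ; 0ℚ; 1ℚ; _+_; _*_; -_; _-_; _≤_; _<_)
  open import Data.Rational.Properties
  open import Relation.Binary.PropositionalEquality
  open import Data.Rational.Solver using (module +-*-Solver)
  open +-*-Solver using (solve; _:+_; _:=_)
  open BooleanTests

  Σall-cong : ∀ {n} {f g : Fin n → ℚ} → (∀ i → f i ≡ g i) → Σall f ≡ Σall g
  Σall-cong {zero}  f≗g = refl
  Σall-cong {suc n} f≗g = cong₂ _+_ (f≗g zero) (Σall-cong (λ i → f≗g (suc i)))

  Σall-zero : ∀ {n} → Σall {n} (λ _ → 0ℚ) ≡ 0ℚ
  Σall-zero {zero}  = refl
  Σall-zero {suc n} = trans (+-identityˡ _) (Σall-zero {n})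

  Σall-+ : ∀ {n} (f g : Fin n → ℚ) → Σall (λ i → f i + g i) ≡ Σall f + Σall g
  Σall-+ {zero}  f g = refl
  Σall-+ {suc n} f g =
    trans (cong (f zero + g zero +_) (Σall-+ (λ i → f (suc i)) (λ i → g (suc i))))
          (interchange (f zero) (g zero) _ _)
    where
    interchange : ∀ a b c d → (a + b) + (c + d) ≡ (a + c) + (b + d)
    interchange = solve 4 (λ a b c d → (a :+ b) :+ (c :+ d) := (a :+ c) :+ (b :+ d)) refl

  Σall-*ˡ : ∀ {n} (c : ℚ) (f : Fin n → ℚ) → Σall (λ i → c * f i) ≡ c * Σall f
  Σall-*ˡ {zero}  c f = sym (*-zeroʳ c)
  Σall-*ˡ {suc n} c f =
    trans (cong (c * f zero +_) (Σall-*ˡ c (λ i → f (suc i)))) (sym (*-distribˡ-+ c (f zero) _))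

  Σall-neg : ∀ {n} (f : Fin n → ℚ) → Σall (λ i → - f i) ≡ - Σall f
  Σall-neg {zero}  f = refl
  Σall-neg {suc n} f =
    trans (cong (- f zero +_) (Σall-neg (λ i → f (suc i)))) (sym (neg-distrib-+ (f zero) _))

  Σall-- : ∀ {n} (f g : Fin n → ℚ) → Σall (λ i → f i - g i) ≡ Σall f - Σall g
  Σall-- f g = trans (Σall-+ f (λ i → - g i)) (cong (Σall f +_) (Σall-neg g))

  Σall-swap : ∀ {m n} (f : Fin m → Fin n → ℚ) →
              Σall (λ i → Σall (λ j → f i j)) ≡ Σall (λ j → Σall (λ i → f i j))
  Σall-swap {zero}  {n} f = sym (Σall-zero {n})
  Σall-swap {suc m} {n} f =
    trans (cong (Σall (f zero) +_) (Σall-swap (λ i j → f (suc i) j)))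
          (sym (Σall-+ (f zero) _))

  Σall-mono-≤ : ∀ {n} {f g : Fin n → ℚ} → (∀ i → f i ≤ g i) → Σall f ≤ Σall g
  Σall-mono-≤ {zero}  f≤g = ≤-refl
  Σall-mono-≤ {suc n} f≤g = +-mono-≤ (f≤g zero) (Σall-mono-≤ (λ i → f≤g (suc i)))

  Σall-mono-< : ∀ {n} {f g : Fin n → ℚ} → (∀ i → f i ≤ g i) → ∀ i → f i < g i → Σall f < Σall g
  Σall-mono-< {suc n} f≤g zero    fi<gi = +-mono-<-≤ fi<gi (Σall-mono-≤ (λ i → f≤g (suc i)))
  Σall-mono-< {suc n} f≤g (suc i) fi<gi = +-mono-≤-< (f≤g zero) (Σall-mono-< (λ i → f≤g (suc i)) i fi<gi)

  Σall-nonneg : ∀ {n} {f : Fin n → ℚ} → (∀ i → 0ℚ ≤ f i) → 0ℚ ≤ Σall f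
  Σall-nonneg {n} {f} f≥0 = subst (_≤ Σall f) (Σall-zero {n}) (Σall-mono-≤ f≥0)

  Σall-pos : ∀ {n} {f : Fin n → ℚ} → (∀ i → 0ℚ ≤ f i) → ∀ i → 0ℚ < f i → 0ℚ < Σall f
  Σall-pos {n} {f} f≥0 i fi>0 = subst (_< Σall f) (Σall-zero {n}) (Σall-mono-< f≥0 i fi>0)

  Σ⟨_⟩_ : ∀ {n} → (Fin n → Bool) → (Fin n → ℚ) → ℚ
  Σ⟨ P ⟩ f = Σall (λ j → if P j then f j else 0ℚ)

  Σ⟨⟩-cong : ∀ {n} (P : Fin n → Bool) {f g : Fin n → ℚ} →
             (∀ j → P j ≡ true → f j ≡ g j) → Σ⟨ P ⟩ f ≡ Σ⟨ P ⟩ g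
  Σ⟨⟩-cong P f≗g = Σall-cong λ j → lemma (P j) (f≗g j)
    where
    lemma : ∀ b {x y} → (b ≡ true → x ≡ y) → (if b then x else 0ℚ) ≡ (if b then y else 0ℚ)
    lemma true  x≡y = x≡y refl
    lemma false _   = refl

  Σ⟨⟩-const : ∀ {n} (P : Fin n → Bool) (c : ℚ) →
              Σ⟨ P ⟩ (λ _ → c) ≡ c * Σ⟨ P ⟩ (λ _ → 1ℚ)
  Σ⟨⟩-const P c = trans (Σall-cong λ j → lemma (P j)) (Σall-*ˡ c (λ j → if P j then 1ℚ else 0ℚ))
    where
    lemma : ∀ b → (if b then c else 0ℚ) ≡ c * (if b then 1ℚ else 0ℚ)
    lemma true  = sym (*-identityʳ c)
    lemma false = sym (*-zeroʳ c)

  Σ⟨==⟩ : ∀ {n} (t : Fin n) (c : ℚ) → Σ⟨ _== t ⟩ (λ _ → c) ≡ c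
  Σ⟨==⟩ {suc n} zero    c = trans (cong (c +_) (Σall-zero {n})) (+-identityʳ c)
  Σ⟨==⟩ {suc n} (suc t) c = trans (+-identityˡ _) (Σ⟨==⟩ t c)

  Σ⟨⟩-extract : ∀ {n} (P : Fin n → Bool) (f : Fin n → ℚ) t → P t ≡ true →
                Σ⟨ P ⟩ f ≡ f t + Σ⟨ (λ j → P j ∧ not (j == t)) ⟩ f
  Σ⟨⟩-extract P f t Pt =
    trans (Σall-cong split)
          (trans (Σall-+ (λ j → if j == t then f t else 0ℚ) _)
                 (cong (_+ Σ⟨ (λ j → P j ∧ not (j == t)) ⟩ f) (Σ⟨==⟩ t (f t))))
    where
    split : ∀ j → (if P j then f j else 0ℚ) ≡
                  (if j == t then f t else 0ℚ) + (if P j ∧ not (j == t) then f j else 0ℚ)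
    split j with j == t in j=t
    ... | true rewrite ==⇒≡ j t j=t | Pt = sym (+-identityʳ (f t))
    ... | false with P j
    ...   | true  = sym (+-identityˡ (f j))
    ...   | false = sym (+-identityˡ 0ℚ)

  Σ⟨⟩-complement : ∀ {n} (P : Fin n → Bool) (f : Fin n → ℚ) →
                   Σ⟨ P ⟩ f + Σ⟨ (λ j → not (P j)) ⟩ f ≡ Σall f
  Σ⟨⟩-complement P f =
    trans (sym (Σall-+ (λ j → if P j then f j else 0ℚ) (λ j → if not (P j) then f j else 0ℚ)))
          (Σall-cong λ j → lemma (P j))
    where
    lemma : ∀ b {x} → (if b then x else 0ℚ) + (if not b then x else 0ℚ) ≡ x
    lemma true  = +-identityʳ _
    lemma false = +-identityˡ _

  ΣS≡Σ⟨lookup⟩ : ∀ {n} (S : Subset n) (f : Fin n → ℚ) → ΣS S f ≡ Σ⟨ lookup S ⟩ f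
  ΣS≡Σ⟨lookup⟩ []      f = refl
  ΣS≡Σ⟨lookup⟩ (b ∷ S) f = cong ((if b then f zero else 0ℚ) +_) (ΣS≡Σ⟨lookup⟩ S (λ i → f (suc i)))

module RationalFacts where
  open import Data.Sum using (inj₁; inj₂)
  open import Data.Rational
    using (ℚ; 0ℚ; 1ℚ; _*_; -_; _-_; _≤_; _<_; _⊔_; 1/_; >-nonZero; positive; nonNegative)
  open import Data.Rational.Properties
  open import Relation.Binary.PropositionalEquality
  open import Relation.Nullary using (yes; no)
  open import Data.Empty using (⊥-elim)
  open import Data.Rational.Solver using (module +-*-Solver)
  open +-*-Solver using (solve; _:-_; :-_; _:=_; con)

  -- junk value 0 on nonpositive arguments
  recip : ℚ → ℚ
  recip q with 0ℚ <? q
  ... | yes q>0 = 1/_ q {{>-nonZero q>0}}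
  ... | no  _   = 0ℚ

  *-recip : ∀ q → 0ℚ < q → q * recip q ≡ 1ℚ
  *-recip q q>0 with 0ℚ <? q
  ... | yes q>0' = *-inverseʳ q {{>-nonZero q>0'}}
  ... | no  q≯0  = ⊥-elim (q≯0 q>0)

  recip-nonneg : ∀ q → 0ℚ ≤ recip q
  recip-nonneg q with 0ℚ <? q
  ... | yes q>0 = <⇒≤ (positive⁻¹ _ {{1/pos⇒pos q {{positive q>0}}}})
  ... | no  _   = ≤-refl

  *-nonneg : ∀ {a b} → 0ℚ ≤ a → 0ℚ ≤ b → 0ℚ ≤ a * b
  *-nonneg {a} {b} a≥0 b≥0 =
    nonNegative⁻¹ _ {{nonNeg*nonNeg⇒nonNeg a {{nonNegative a≥0}} b {{nonNegative b≥0}}}}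

  _⁺ : ℚ → ℚ
  x ⁺ = x ⊔ 0ℚ

  ⁺-nonneg : ∀ x → 0ℚ ≤ x ⁺
  ⁺-nonneg x = p≤q⊔p x 0ℚ

  neg-sub : ∀ x y → - (x - y) ≡ y - x
  neg-sub = solve 2 (λ x y → :- (x :- y) := y :- x) refl

  ⁺-difference : ∀ x y → (x - y) ⁺ - (y - x) ⁺ ≡ x - y
  ⁺-difference x y with ≤-total 0ℚ (x - y)
  ... | inj₁ x≥y = begin
    (x - y) ⁺ - (y - x) ⁺ ≡⟨ cong₂ _-_ (p≥q⇒p⊔q≡p x≥y)
                                     (p≤q⇒p⊔q≡q (subst (_≤ 0ℚ) (neg-sub x y) (neg-antimono-≤ x≥y))) ⟩
    (x - y) - 0ℚ          ≡⟨ +-identityʳ (x - y) ⟩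
    x - y                 ∎
    where open ≡-Reasoning
  ... | inj₂ x≤y = begin
    (x - y) ⁺ - (y - x) ⁺ ≡⟨ cong₂ _-_ (p≤q⇒p⊔q≡q x≤y)
                                     (p≥q⇒p⊔q≡p (subst (0ℚ ≤_) (neg-sub x y) (neg-antimono-≤ x≤y))) ⟩
    0ℚ - (y - x)          ≡⟨ solve 2 (λ x y → con 0ℚ :- (y :- x) := x :- y) refl x y ⟩
    x - y                 ∎
    where open ≡-Reasoning

module CompositionBasics where
  open BooleanTests
  open import Data.Nat using (ℕ; zero; suc; _<_; _≤ᵇ_)
  open import Data.Fin using (Fin; zero; suc; toℕ; fromℕ<)
  open import Data.Fin.Properties using (toℕ<n; toℕ-fromℕ<; toℕ-injective)
  open import Data.Vec.Properties using (tabulate∘lookup; tabulate-cong)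
  open import Data.Nat.Properties using (≰⇒>; <⇒≱; ≤⇒≤ᵇ; ≤ᵇ⇒≤)
  open import Data.Bool using (Bool; true; false; not; T)
  open import Data.Product using (Σ; _,_)
  open import Data.Empty using (⊥-elim)
  open import Data.Vec using (Vec; lookup)
  open import Data.Vec.Membership.Propositional using (_∈_)
  open import Data.Vec.Relation.Unary.Any using (here; there)
  open import Relation.Binary.PropositionalEquality

  ∈⇒lookup : ∀ {A : Set} {n} {x : A} {xs : Vec A n} → x ∈ xs → Σ (Fin n) λ i → lookup xs i ≡ x
  ∈⇒lookup (here refl) = zero , refl
  ∈⇒lookup (there x∈xs) with ∈⇒lookup x∈xs
  ... | i , eq = suc i , eq

  lumpOf : ∀ {n} → Composition n → Fin n → ℕ
  lumpOf F i = toℕ (lookup (Composition.lump F) i)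

  lumpOf<k : ∀ {n} (F : Composition n) j → lumpOf F j < Composition.k F
  lumpOf<k F j = toℕ<n (lookup (Composition.lump F) j)

  lump-nonempty : ∀ {n} (F : Composition n) q → q < Composition.k F → Σ (Fin n) λ j → lumpOf F j ≡ q
  lump-nonempty F q q<k with ∈⇒lookup (Composition.surj F (fromℕ< q<k))
  ... | i , eq = i , trans (cong toℕ eq) (toℕ-fromℕ< q<k)

  sameLumps⇒SameComp : ∀ {n} (G F : Composition n) → Composition.k G ≡ Composition.k F →
                       (∀ j → lumpOf G j ≡ lumpOf F j) → SameComp G F
  sameLumps⇒SameComp (composition k ℓ _) (composition .k ℓ′ _) refl ℓ≗ℓ′ =
    refl , trans (sym (tabulate∘lookup ℓ))
                 (trans (tabulate-cong (λ j → toℕ-injective (ℓ≗ℓ′ j))) (tabulate∘lookup ℓ′))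

  SameComp-sym : ∀ {n} {G F : Composition n} → SameComp G F → SameComp F G
  SameComp-sym (refl , lumps≡) = refl , sym lumps≡

  atMost beyond : ∀ {n} → Composition n → ℕ → Fin n → Bool
  atMost F p j = lumpOf F j ≤ᵇ p
  beyond F p j = not (atMost F p j)

  beyond⇒< : ∀ {n} (F : Composition n) p j → beyond F p j ≡ true → p < lumpOf F j
  beyond⇒< F p j eq with lumpOf F j ≤ᵇ p in ℓj≤p
  ... | false = ≰⇒> λ ℓj≤p′ → subst T ℓj≤p (≤⇒≤ᵇ ℓj≤p′)

  <⇒beyond : ∀ {n} (F : Composition n) p j → p < lumpOf F j → beyond F p j ≡ true
  <⇒beyond F p j p<ℓj with lumpOf F j ≤ᵇ p in ℓj≤p
  ... | true  = ⊥-elim (<⇒≱ p<ℓj (≤ᵇ⇒≤ _ _ (≡true⇒T ℓj≤p)))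
  ... | false = refl

module Rank where
  open import Data.Nat using (ℕ; zero; suc; _+_; _*_; _∸_; _≤_; _<_; z≤n; s≤s)
  open import Data.Nat.Properties
  open import Data.Fin using (Fin; zero; suc)
  open import Data.Fin.Properties using (injective⇒≤)
  open import Data.Product using (proj₁; proj₂)
  open import Data.Vec using (lookup)
  open import Relation.Binary.PropositionalEquality
  open CompositionBasics

  sumℕ : ∀ {n} → (Fin n → ℕ) → ℕ
  sumℕ {zero}  f = 0
  sumℕ {suc n} f = f zero + sumℕ (λ i → f (suc i))

  sumℕ-mono-≤ : ∀ {n} {f g : Fin n → ℕ} → (∀ i → f i ≤ g i) → sumℕ f ≤ sumℕ g
  sumℕ-mono-≤ {zero}  f≤g = z≤n
  sumℕ-mono-≤ {suc n} f≤g = +-mono-≤ (f≤g zero) (sumℕ-mono-≤ (λ i → f≤g (suc i)))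

  sumℕ-mono-< : ∀ {n} {f g : Fin n → ℕ} → (∀ i → f i ≤ g i) → ∀ i → f i < g i → sumℕ f < sumℕ g
  sumℕ-mono-< {suc n} f≤g zero    fi<gi = +-mono-<-≤ fi<gi (sumℕ-mono-≤ (λ i → f≤g (suc i)))
  sumℕ-mono-< {suc n} f≤g (suc i) fi<gi = +-mono-≤-< (f≤g zero) (sumℕ-mono-< (λ i → f≤g (suc i)) i fi<gi)

  sumℕ-≤ : ∀ {n} {f : Fin n → ℕ} c → (∀ i → f i ≤ c) → sumℕ f ≤ n * c
  sumℕ-≤ {zero}  c f≤c = z≤n
  sumℕ-≤ {suc n} c f≤c = +-mono-≤ (f≤c zero) (sumℕ-≤ c (λ i → f≤c (suc i)))

  k≤n : ∀ {n} (G : Composition n) → Composition.k G ≤ n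
  k≤n G = injective⇒≤ {f = representative} λ {a} {b} eq →
    trans (sym (proj₂ (∈⇒lookup (Composition.surj G a))))
          (trans (cong (lookup (Composition.lump G)) eq) (proj₂ (∈⇒lookup (Composition.surj G b))))
    where representative = λ q → proj₁ (∈⇒lookup (Composition.surj G q))

  -- lexicographic in (n − number of lumps, sum of the lump indices)
  rank : ∀ {n} → Composition n → ℕ
  rank {n} G = (n ∸ Composition.k G) * suc (n * n) + sumℕ (lumpOf G)

  sumℕ-lumpOf< : ∀ {n} (G : Composition n) → sumℕ (lumpOf G) < suc (n * n)
  sumℕ-lumpOf< {n} G = s≤s (sumℕ-≤ n λ i → <⇒≤ (<-≤-trans (lumpOf<k G i) (k≤n G)))

  rank-<-lumpCount : ∀ {n} (G F : Composition n) → Composition.k F < Composition.k G → rank G < rank F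
  rank-<-lumpCount {n} G F kF<kG = begin-strict
    (n ∸ kG) * M + sumℕ (lumpOf G) <⟨ +-monoʳ-< ((n ∸ kG) * M) (sumℕ-lumpOf< G) ⟩
    (n ∸ kG) * M + M               ≡⟨ +-comm ((n ∸ kG) * M) M ⟩
    suc (n ∸ kG) * M               ≤⟨ *-monoˡ-≤ M (∸-monoʳ-< kF<kG (k≤n G)) ⟩
    (n ∸ Composition.k F) * M      ≤⟨ m≤m+n _ _ ⟩
    rank F                         ∎
    where
    open ≤-Reasoning
    kG = Composition.k G
    M = suc (n * n)

  rank-<-lumpOf : ∀ {n} (G F : Composition n) → Composition.k G ≡ Composition.k F →
                  sumℕ (lumpOf G) < sumℕ (lumpOf F) → rank G < rank F
  rank-<-lumpOf {n} G F kG≡kF ΣG<ΣF =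
    subst (λ k → (n ∸ Composition.k G) * suc (n * n) + sumℕ (lumpOf G) <
                 (n ∸ k) * suc (n * n) + sumℕ (lumpOf F))
          kG≡kF (+-monoʳ-< _ ΣG<ΣF)

module ConeMembership where
  open import Data.Nat as ℕ using (ℕ; zero; suc; _≡ᵇ_; _≤ᵇ_)
  import Data.Nat.Properties as ℕₚ
  open import Data.Fin using (Fin)
  open import Data.Bool using (Bool; true; false; if_then_else_; T)
  open import Data.Product using (_,_)
  open import Data.Rational using (ℚ; 0ℚ; 1ℚ; _+_; _*_; -_; _-_; _≤_; _<_)
  open import Data.Rational.Properties
  open import Relation.Binary.PropositionalEquality
  open import Relation.Nullary using (¬_; yes; no)
  open import Data.Empty using (⊥-elim)
  open import Data.Rational.Solver using (module +-*-Solver)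
  open +-*-Solver using (solve; _:+_; _:-_; _:*_; _:=_)
  open BooleanTests
  open FinSum
  open RationalFacts
  open CompositionBasics

  if-− : ∀ b (x y : ℚ) → (if b then x - y else 0ℚ) ≡ (if b then x else 0ℚ) - (if b then y else 0ℚ)
  if-− true  x y = refl
  if-− false x y = refl

  if-Σall : ∀ {n} b (f : Fin n → ℚ) → (if b then Σall f else 0ℚ) ≡ Σall (λ j → if b then f j else 0ℚ)
  if-Σall     true  f = refl
  if-Σall {n} false f = sym (Σall-zero {n})

  -- A nonnegative combination of the e_i − e_j (i weakly left of j) cannot move mass out of a
  -- union of initial lumps: the coefficient of each pair enters Σ⟨ atMost F p ⟩ with sign ≥ 0.
  inCone⇒atMost-nonneg : ∀ {n} (F : Composition n) (h : Fin n → ℚ) → InCone F h →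
                         ∀ p → 0ℚ ≤ Σ⟨ atMost F p ⟩ h
  inCone⇒atMost-nonneg {n} F h (λ' , λ'≥0 , λ'-left , h≡) p =
    subst (0ℚ ≤_) (sym decompose) (Σall-nonneg λ m → Σall-nonneg λ j → term-nonneg m j)
    where
    U = atMost F p
    term : Fin n → Fin n → ℚ
    term m j = (if U m then λ' m j else 0ℚ) - (if U j then λ' m j else 0ℚ)
    term-nonneg : ∀ m j → 0ℚ ≤ term m j
    term-nonneg m j with U m in um | U j in uj
    ... | true  | true  = ≤-reflexive (sym (+-inverseʳ (λ' m j)))
    ... | true  | false = subst (0ℚ ≤_) (sym (+-identityʳ (λ' m j))) (λ'≥0 m j)
    ... | false | false = ≤-refl
    ... | false | true  = ≤-reflexive (cong (λ x → 0ℚ - x) (sym (λ'-left m j right)))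
      where
      right : ¬ WeaklyLeft F m j
      right m≤j = subst T um (ℕₚ.≤⇒≤ᵇ (ℕₚ.≤-trans m≤j (ℕₚ.≤ᵇ⇒≤ _ _ (≡true⇒T uj))))
    decompose : Σ⟨ U ⟩ h ≡ Σall (λ m → Σall (term m))
    decompose = begin
      Σ⟨ U ⟩ h
        ≡⟨ Σ⟨⟩-cong U (λ m _ → h≡ m) ⟩
      Σall (λ m → if U m then Σall (λ' m) - Σall (λ i → λ' i m) else 0ℚ)
        ≡⟨ Σall-cong (λ m → if-− (U m) _ _) ⟩
      Σall (λ m → (if U m then Σall (λ' m) else 0ℚ) - (if U m then Σall (λ i → λ' i m) else 0ℚ))
        ≡⟨ Σall-- {n} _ _ ⟩
      Σall (λ m → if U m then Σall (λ' m) else 0ℚ) - Σall (λ m → if U m then Σall (λ i → λ' i m) else 0ℚ)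
        ≡⟨ cong₂ _-_ (Σall-cong (λ m → if-Σall (U m) (λ' m)))
                     (trans (Σall-cong (λ m → if-Σall (U m) (λ i → λ' i m)))
                            (Σall-swap (λ m i → if U m then λ' i m else 0ℚ))) ⟩
      Σall (λ m → Σall (λ j → if U m then λ' m j else 0ℚ)) -
      Σall (λ m → Σall (λ j → if U j then λ' m j else 0ℚ))
        ≡⟨ sym (Σall-- {n} _ _) ⟩
      Σall (λ m → Σall (λ j → if U m then λ' m j else 0ℚ) - Σall (λ j → if U j then λ' m j else 0ℚ))
        ≡⟨ Σall-cong {n} (λ m → sym (Σall-- {n} _ _)) ⟩
      Σall (λ m → Σall (term m)) ∎
      where open ≡-Reasoning

  atMost-suc : ∀ a q (x : ℚ) →
    (if a ≤ᵇ suc q then x else 0ℚ) ≡ (if a ≤ᵇ q then x else 0ℚ) + (if a ≡ᵇ suc q then x else 0ℚ)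
  atMost-suc zero          q       x = sym (+-identityʳ x)
  atMost-suc (suc zero)    zero    x = sym (+-identityˡ x)
  atMost-suc (suc (suc a)) zero    x = refl
  atMost-suc (suc a)       (suc q) x rewrite <ᵇ-suc a (suc q) | <ᵇ-suc a q = atMost-suc a q x

  atMost-zero : ∀ a (x : ℚ) → (if a ≤ᵇ 0 then x else 0ℚ) ≡ (if a ≡ᵇ 0 then x else 0ℚ)
  atMost-zero zero    x = refl
  atMost-zero (suc a) x = refl

  -- Within a lump q, A balances h against its average over the lump; B then carries the
  -- prefix sum s q uniformly from lump q to lump q + 1.
  module ConeWitness {n} (F : Composition n) (h : Fin n → ℚ) (Σh≡0 : Σall h ≡ 0ℚ)
         (prefix≥0 : ∀ p → suc p ℕ.< Composition.k F → 0ℚ ≤ Σ⟨ atMost F p ⟩ h) where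
    k = Composition.k F
    ℓ = lumpOf F

    sameLump : ℕ → Fin n → Bool
    sameLump q j = ℓ j ≡ᵇ q

    size : ℕ → ℚ
    size q = Σ⟨ sameLump q ⟩ (λ _ → 1ℚ)

    s : ℕ → ℚ
    s q = Σ⟨ atMost F q ⟩ h

    s-before : ℕ → ℚ
    s-before zero    = 0ℚ
    s-before (suc q) = s q

    lumpSum : ℕ → ℚ
    lumpSum q = Σ⟨ sameLump q ⟩ h

    A B λ' : Fin n → Fin n → ℚ
    A i j = if ℓ i ≡ᵇ ℓ j then recip (size (ℓ i)) * (h i - h j) ⁺ else 0ℚ
    B i j = if ℓ j ≡ᵇ suc (ℓ i) then s (ℓ i) * recip (size (ℓ i)) * recip (size (ℓ j)) else 0ℚ
    λ' i j = A i j + B i j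

    size-pos : ∀ q → q ℕ.< k → 0ℚ < size q
    size-pos q q<k with lump-nonempty F q q<k
    ... | j , ℓj≡q =
      Σall-pos 1or0≥0 j (subst (λ b → 0ℚ < (if b then 1ℚ else 0ℚ)) (sym (≡⇒≡ᵇ-true ℓj≡q)) (positive⁻¹ 1ℚ))
      where
      1or0≥0 : ∀ i → 0ℚ ≤ (if ℓ i ≡ᵇ q then 1ℚ else 0ℚ)
      1or0≥0 i with ℓ i ≡ᵇ q
      ... | true  = <⇒≤ (positive⁻¹ 1ℚ)
      ... | false = ≤-refl

    size*recip : ∀ q → q ℕ.< k → size q * recip (size q) ≡ 1ℚ
    size*recip q q<k = *-recip (size q) (size-pos q q<k)

    s-last : ∀ p → k ℕ.≤ suc p → s p ≡ 0ℚ
    s-last p k≤1+p = trans (Σall-cong all-in) Σh≡0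
      where
      all-in : ∀ j → (if ℓ j ≤ᵇ p then h j else 0ℚ) ≡ h j
      all-in j with ℓ j ≤ᵇ p in eq
      ... | true  = refl
      ... | false = ⊥-elim (subst T eq (ℕₚ.≤⇒≤ᵇ (ℕₚ.≤-pred (ℕₚ.≤-trans (lumpOf<k F j) k≤1+p))))

    s≡s-before+lumpSum : ∀ p → s p ≡ s-before p + lumpSum p
    s≡s-before+lumpSum zero    = trans (Σall-cong (λ j → atMost-zero (ℓ j) (h j))) (sym (+-identityˡ _))
    s≡s-before+lumpSum (suc q) = trans (Σall-cong (λ j → atMost-suc (ℓ j) q (h j))) (Σall-+ {n} _ _)

    ΣA-row−column : ∀ m → Σall (A m) - Σall (λ i → A i m) ≡
                          recip (size (ℓ m)) * (h m * size (ℓ m) - lumpSum (ℓ m))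
    ΣA-row−column m = begin
      Σall (A m) - Σall (λ i → A i m)
        ≡⟨ cong₂ _-_ (trans (Σall-cong row) (Σall-*ˡ {n} c _)) (trans (Σall-cong column) (Σall-*ˡ {n} c _)) ⟩
      c * Σ⟨ E ⟩ (λ j → (h m - h j) ⁺) - c * Σ⟨ E ⟩ (λ j → (h j - h m) ⁺)
        ≡⟨ solve 3 (λ c X Y → c :* X :- c :* Y := c :* (X :- Y)) refl c _ _ ⟩
      c * (Σ⟨ E ⟩ (λ j → (h m - h j) ⁺) - Σ⟨ E ⟩ (λ j → (h j - h m) ⁺))
        ≡⟨ cong (c *_) (sym (Σall-- {n} _ _)) ⟩
      c * Σall (λ j → (if E j then (h m - h j) ⁺ else 0ℚ) - (if E j then (h j - h m) ⁺ else 0ℚ))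
        ≡⟨ cong (c *_) (Σall-cong λ j → trans (sym (if-− (E j) _ _))
                                              (cong (λ z → if E j then z else 0ℚ) (⁺-difference (h m) (h j)))) ⟩
      c * Σall (λ j → if E j then h m - h j else 0ℚ)
        ≡⟨ cong (c *_) (trans (Σall-cong λ j → if-− (E j) _ _) (Σall-- {n} _ _)) ⟩
      c * (Σ⟨ E ⟩ (λ _ → h m) - lumpSum (ℓ m))
        ≡⟨ cong (λ z → c * (z - lumpSum (ℓ m))) (Σ⟨⟩-const E (h m)) ⟩
      c * (h m * size (ℓ m) - lumpSum (ℓ m)) ∎
      where
      open ≡-Reasoning
      c = recip (size (ℓ m))
      E = sameLump (ℓ m)
      row : ∀ j → A m j ≡ c * (if E j then (h m - h j) ⁺ else 0ℚ)
      row j with ℓ j ≡ᵇ ℓ m in eq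
      ... | true  rewrite ≡ᵇ-sym (ℓ m) (ℓ j) | eq = refl
      ... | false rewrite ≡ᵇ-sym (ℓ m) (ℓ j) | eq = sym (*-zeroʳ c)
      column : ∀ i → A i m ≡ c * (if E i then (h i - h m) ⁺ else 0ℚ)
      column i with ℓ i ≡ᵇ ℓ m in eq
      ... | true  = cong (λ z → recip (size z) * (h i - h m) ⁺) (≡ᵇ-true⇒≡ eq)
      ... | false = sym (*-zeroʳ c)

    ΣB-row : ∀ m → Σall (B m) ≡ s (ℓ m) * recip (size (ℓ m))
    ΣB-row m = begin
      Σall (B m)
        ≡⟨ Σ⟨⟩-cong (sameLump (suc p)) (λ j eq → cong (λ z → a * recip (size z)) (≡ᵇ-true⇒≡ eq)) ⟩
      Σ⟨ sameLump (suc p) ⟩ (λ _ → a * recip (size (suc p)))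
        ≡⟨ Σ⟨⟩-const (sameLump (suc p)) _ ⟩
      a * recip (size (suc p)) * size (suc p)
        ≡⟨ solve 3 (λ a r N → a :* r :* N := a :* (N :* r)) refl a _ _ ⟩
      a * (size (suc p) * recip (size (suc p)))
        ≡⟨ next-lump ⟩
      a ∎
      where
      open ≡-Reasoning
      p = ℓ m
      a = s p * recip (size p)
      z = size (suc p) * recip (size (suc p))
      next-lump : a * z ≡ a
      next-lump with suc p ℕ.<? k
      ... | yes 1+p<k = trans (cong (a *_) (size*recip (suc p) 1+p<k)) (*-identityʳ a)
      ... | no  1+p≮k = trans (cong (_* z) a≡0) (trans (*-zeroˡ z) (sym a≡0))
        where a≡0 = trans (cong (_* recip (size p)) (s-last p (ℕₚ.≮⇒≥ 1+p≮k))) (*-zeroˡ (recip (size p)))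

    ΣB-column : ∀ m → Σall (λ i → B i m) ≡ s-before (ℓ m) * recip (size (ℓ m))
    ΣB-column m with ℓ m | lumpOf<k F m
    ... | zero  | _ = trans (Σall-zero {n}) (sym (*-zeroˡ (recip (size zero))))
    ... | suc q | q+1<k = begin
      Σall (λ i → if suc q ≡ᵇ suc (ℓ i) then s (ℓ i) * recip (size (ℓ i)) * r else 0ℚ)
        ≡⟨ Σall-cong (λ i → cong (λ b → if b then s (ℓ i) * recip (size (ℓ i)) * r else 0ℚ)
                                 (≡ᵇ-sym q (ℓ i))) ⟩
      Σ⟨ sameLump q ⟩ (λ i → s (ℓ i) * recip (size (ℓ i)) * r)
        ≡⟨ Σ⟨⟩-cong (sameLump q) (λ i eq → cong (λ z → s z * recip (size z) * r) (≡ᵇ-true⇒≡ eq)) ⟩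
      Σ⟨ sameLump q ⟩ (λ _ → s q * recip (size q) * r)
        ≡⟨ Σ⟨⟩-const (sameLump q) _ ⟩
      s q * recip (size q) * r * size q
        ≡⟨ solve 4 (λ a b c d → a :* b :* c :* d := a :* c :* (d :* b)) refl (s q) _ r _ ⟩
      s q * r * (size q * recip (size q))
        ≡⟨ cong (s q * r *_) (size*recip q (ℕₚ.<-trans (ℕₚ.n<1+n q) q+1<k)) ⟩
      s q * r * 1ℚ
        ≡⟨ *-identityʳ _ ⟩
      s q * r ∎
      where
      open ≡-Reasoning
      r = recip (size (suc q))

    balance : ∀ m → h m ≡ Σall (λ' m) - Σall (λ i → λ' i m)
    balance m = sym (begin
      Σall (λ' m) - Σall (λ i → λ' i m)
        ≡⟨ cong₂ _-_ (Σall-+ (A m) (B m)) (Σall-+ (λ i → A i m) (λ i → B i m)) ⟩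
      (Σall (A m) + Σall (B m)) - (Σall (λ i → A i m) + Σall (λ i → B i m))
        ≡⟨ solve 4 (λ a b c d → (a :+ b) :- (c :+ d) := (a :- c) :+ b :- d) refl
                   (Σall (A m)) (Σall (B m)) (Σall (λ i → A i m)) (Σall (λ i → B i m)) ⟩
      (Σall (A m) - Σall (λ i → A i m)) + Σall (B m) - Σall (λ i → B i m)
        ≡⟨ cong₂ (λ x y → x + y - Σall (λ i → B i m)) (ΣA-row−column m) (ΣB-row m) ⟩
      c * (h m * N - lumpSum p) + s p * c - Σall (λ i → B i m)
        ≡⟨ cong₂ (λ x y → c * (h m * N - lumpSum p) + x * c - y) (s≡s-before+lumpSum p) (ΣB-column m) ⟩
      c * (h m * N - lumpSum p) + (s-before p + lumpSum p) * c - s-before p * c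
        ≡⟨ solve 5 (λ c x N H S → c :* (x :* N :- H) :+ (S :+ H) :* c :- S :* c := x :* (N :* c)) refl
                   c (h m) N (lumpSum p) (s-before p) ⟩
      h m * (N * c)
        ≡⟨ cong (h m *_) (size*recip p (lumpOf<k F m)) ⟩
      h m * 1ℚ
        ≡⟨ *-identityʳ (h m) ⟩
      h m ∎)
      where
      open ≡-Reasoning
      p = ℓ m
      c = recip (size p)
      N = size p

    λ'-nonneg : ∀ i j → 0ℚ ≤ λ' i j
    λ'-nonneg i j = subst (_≤ λ' i j) (+-identityʳ 0ℚ) (+-mono-≤ A-nonneg B-nonneg)
      where
      A-nonneg : 0ℚ ≤ A i j
      A-nonneg with ℓ i ≡ᵇ ℓ j
      ... | true  = *-nonneg (recip-nonneg (size (ℓ i))) (⁺-nonneg (h i - h j))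
      ... | false = ≤-refl
      B-nonneg : 0ℚ ≤ B i j
      B-nonneg with ℓ j ≡ᵇ suc (ℓ i) in eq
      ... | true  = *-nonneg (*-nonneg (prefix≥0 (ℓ i) (subst (ℕ._< k) (≡ᵇ-true⇒≡ eq) (lumpOf<k F j)))
                                      (recip-nonneg (size (ℓ i))))
                             (recip-nonneg (size (ℓ j)))
      ... | false = ≤-refl

    λ'-left : ∀ i j → ¬ WeaklyLeft F i j → λ' i j ≡ 0ℚ
    λ'-left i j i≰j with ℓ i ≡ᵇ ℓ j in eq₁ | ℓ j ≡ᵇ suc (ℓ i) in eq₂
    ... | true  | _     = ⊥-elim (i≰j (ℕₚ.≤-reflexive (≡ᵇ-true⇒≡ eq₁)))
    ... | false | true  = ⊥-elim (i≰j (subst (ℓ i ℕ.≤_) (sym (≡ᵇ-true⇒≡ eq₂)) (ℕₚ.n≤1+n (ℓ i))))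
    ... | false | false = refl

  atMost-nonneg⇒inCone : ∀ {n} (F : Composition n) (h : Fin n → ℚ) → Σall h ≡ 0ℚ →
    (∀ p → suc p ℕ.< Composition.k F → 0ℚ ≤ Σ⟨ atMost F p ⟩ h) → InCone F h
  atMost-nonneg⇒inCone F h Σh≡0 prefix≥0 = λ' , λ'-nonneg , λ'-left , balance
    where open ConeWitness F h Σh≡0 prefix≥0

module Dominance where
  open import Data.Nat as ℕ using (ℕ; zero; suc; _≡ᵇ_; _<ᵇ_)
  import Data.Nat.Properties as ℕₚ
  open import Data.Fin using (Fin; zero; suc)
  open import Data.Fin.Properties using (suc-injective)
  open import Data.Bool using (Bool; true; false; if_then_else_; _∧_; not; T; _≟_)
  open import Data.Bool.Properties using (∧-conicalʳ)
  open import Data.Product using (_×_; _,_; proj₁; proj₂)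
  open import Data.Sum using (inj₁; inj₂)
  open import Data.List using (List; []; _∷_; filter; allFin)
  open import Data.List.Membership.Propositional using (_∈_)
  open import Data.List.Membership.Propositional.Properties using (∈-filter⁺; ∈-filter⁻; ∈-allFin)
  open import Data.List.Relation.Unary.Any as Any using (here; there)
  open import Data.List.Extrema ℕₚ.≤-totalOrder using (argmax; argmax-sel; v≤f[argmax]⁺)
  open import Data.Rational using (ℚ; 0ℚ; 1ℚ; _+_; -_; _-_; _≤_; _<_)
  open import Data.Rational.Properties hiding (_≟_)
  open import Relation.Binary.PropositionalEquality
  open import Data.Empty using (⊥-elim)
  open import Function using (case_of_)
  open BooleanTests
  open FinSum

  module _ {n} (κ : Fin n → ℕ) where
    argmaxOr : Fin n → List (Fin n) → Fin n
    argmaxOr d []       = d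
    argmaxOr d (x ∷ xs) = argmax κ x xs

    argmaxOr-spec : ∀ d xs {w} → w ∈ xs →
                    argmaxOr d xs ∈ xs × (∀ {j} → j ∈ xs → κ j ℕ.≤ κ (argmaxOr d xs))
    argmaxOr-spec d (x ∷ xs) _ = selected , maximal
      where
      selected : argmax κ x xs ∈ x ∷ xs
      selected with argmax-sel κ x xs
      ... | inj₁ ≡x   = subst (_∈ x ∷ xs) (sym ≡x) (here refl)
      ... | inj₂ ∈xs  = there ∈xs
      maximal : ∀ {j} → j ∈ x ∷ xs → κ j ℕ.≤ κ (argmax κ x xs)
      maximal (here refl)  = v≤f[argmax]⁺ {f = κ} x xs (inj₁ ℕₚ.≤-refl)
      maximal (there j∈xs) = v≤f[argmax]⁺ {f = κ} x xs (inj₂ (Any.map (λ { refl → ℕₚ.≤-refl }) j∈xs))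

    -- falls back to d when T is empty
    top : Fin n → (Fin n → Bool) → Fin n
    top d T = argmaxOr d (filter (λ j → T j ≟ true) (allFin n))

    top-spec : ∀ d T w → T w ≡ true → T (top d T) ≡ true × (∀ j → T j ≡ true → κ j ℕ.≤ κ (top d T))
    top-spec d T w Tw =
      proj₂ (∈-filter⁻ T? {xs = allFin n} (proj₁ spec)) , λ j Tj → proj₂ spec (∈-filter⁺ T? (∈-allFin j) Tj)
      where
      T? = λ j → T j ≟ true
      spec = argmaxOr-spec d (filter T? (allFin n)) (∈-filter⁺ T? (∈-allFin w) Tw)

  pow2 : ℕ → ℚ
  pow2 zero    = 1ℚ
  pow2 (suc R) = pow2 R + pow2 R

  pow2-pos : ∀ R → 0ℚ < pow2 R
  pow2-pos zero    = positive⁻¹ 1ℚ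
  pow2-pos (suc R) = subst (_< pow2 R + pow2 R) (+-identityʳ 0ℚ) (+-mono-< (pow2-pos R) (pow2-pos R))

  Σ⟨⟩-atMostOne : ∀ {n} (P : Fin n → Bool) (c : ℚ) → 0ℚ ≤ c →
                  (∀ i j → P i ≡ true → P j ≡ true → i ≡ j) → Σ⟨ P ⟩ (λ _ → c) ≤ c
  Σ⟨⟩-atMostOne {zero}  P c c≥0 unique = c≥0
  Σ⟨⟩-atMostOne {suc n} P c c≥0 unique with P zero in P0
  ... | true  =
    ≤-reflexive (trans (cong (c +_) (trans (Σall-cong rest-empty) (Σall-zero {n}))) (+-identityʳ c))
    where
    rest-empty : ∀ j → (if P (suc j) then c else 0ℚ) ≡ 0ℚ
    rest-empty j with P (suc j) in Pj
    ... | true  with () ← unique zero (suc j) P0 Pj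
    ... | false = refl
  ... | false = subst (_≤ c) (sym (+-identityˡ _))
                  (Σ⟨⟩-atMostOne (λ j → P (suc j)) c c≥0
                                  (λ i j Pi Pj → suc-injective (unique (suc i) (suc j) Pi Pj)))

  <ᵇ-or-≡ᵇ : ∀ a R (x : ℚ) → a ℕ.< suc R → x ≡ (if a <ᵇ R then x else 0ℚ) + (if a ≡ᵇ R then x else 0ℚ)
  <ᵇ-or-≡ᵇ zero    zero    x _ = sym (+-identityˡ x)
  <ᵇ-or-≡ᵇ zero    (suc R) x _ = sym (+-identityʳ x)
  <ᵇ-or-≡ᵇ (suc a) (suc R) x (ℕ.s≤s a<1+R) = <ᵇ-or-≡ᵇ a R x a<1+R

  Σ⟨⟩-pow2< : ∀ {n} (κ : Fin n → ℕ) → (∀ a b → κ a ≡ κ b → a ≡ b) →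
              ∀ R (P : Fin n → Bool) → (∀ j → P j ≡ true → κ j ℕ.< R) → Σ⟨ P ⟩ (λ j → pow2 (κ j)) < pow2 R
  Σ⟨⟩-pow2< {n} κ κ-inj zero P bound =
    subst (_< 1ℚ) (sym (trans (Σall-cong empty) (Σall-zero {n}))) (positive⁻¹ 1ℚ)
    where
    empty : ∀ j → (if P j then pow2 (κ j) else 0ℚ) ≡ 0ℚ
    empty j with P j in Pj
    ... | true  = ⊥-elim (ℕₚ.n≮0 (bound j Pj))
    ... | false = refl
  Σ⟨⟩-pow2< {n} κ κ-inj (suc R) P bound =
    subst (_< pow2 (suc R)) (sym (trans (Σall-cong split) (Σall-+ {n} _ _))) (+-mono-<-≤ below at)
    where
    P< P≡ : Fin n → Bool
    P< j = P j ∧ (κ j <ᵇ R)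
    P≡ j = P j ∧ (κ j ≡ᵇ R)
    split : ∀ j → (if P j then pow2 (κ j) else 0ℚ) ≡
                  (if P< j then pow2 (κ j) else 0ℚ) + (if P≡ j then pow2 (κ j) else 0ℚ)
    split j with P j in Pj
    ... | true  = <ᵇ-or-≡ᵇ (κ j) R (pow2 (κ j)) (bound j Pj)
    ... | false = sym (+-identityʳ 0ℚ)
    κ≡R : ∀ j → P≡ j ≡ true → κ j ≡ R
    κ≡R j eq = ℕₚ.≡ᵇ⇒≡ (κ j) R (≡true⇒T (∧-conicalʳ (P j) _ eq))
    below : Σ⟨ P< ⟩ (λ j → pow2 (κ j)) < pow2 R
    below = Σ⟨⟩-pow2< κ κ-inj R P< (λ j eq → ℕₚ.<ᵇ⇒< (κ j) R (≡true⇒T (∧-conicalʳ (P j) _ eq)))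
    at : Σ⟨ P≡ ⟩ (λ j → pow2 (κ j)) ≤ pow2 R
    at = subst (_≤ pow2 R) (sym (Σ⟨⟩-cong P≡ (λ j eq → cong pow2 (κ≡R j eq))))
           (Σ⟨⟩-atMostOne P≡ (pow2 R) (<⇒≤ (pow2-pos R))
              (λ i j Pi Pj → κ-inj i j (trans (κ≡R i Pi) (sym (κ≡R j Pj)))))

  module DominantPoint {n} (i0 : Fin n) (κ : Fin n → ℕ) (κ-inj : ∀ a b → κ a ≡ κ b → a ≡ b)
                       (negative : Fin n → Bool) where
    g : Fin n → ℚ
    g j = if negative j then - pow2 (κ j) else pow2 (κ j)

    h : Fin n → ℚ
    h j = if j == i0 then g j - Σall g else g j

    Σh≡0 : Σall h ≡ 0ℚ
    Σh≡0 = begin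
      Σall h                                       ≡⟨ Σall-cong shift ⟩
      Σall (λ j → g j - (if j == i0 then Σall g else 0ℚ)) ≡⟨ Σall-- g _ ⟩
      Σall g - Σ⟨ _== i0 ⟩ (λ _ → Σall g)          ≡⟨ cong (λ x → Σall g - x) (Σ⟨==⟩ i0 (Σall g)) ⟩
      Σall g - Σall g                              ≡⟨ +-inverseʳ (Σall g) ⟩
      0ℚ                                           ∎
      where
      open ≡-Reasoning
      shift : ∀ j → h j ≡ g j - (if j == i0 then Σall g else 0ℚ)
      shift j with j == i0
      ... | true  = refl
      ... | false = sym (+-identityʳ (g j))

    g-bounds : ∀ j → - pow2 (κ j) ≤ g j × g j ≤ pow2 (κ j)
    g-bounds j with negative j
    ... | false = ≤-trans (neg-antimono-≤ (<⇒≤ (pow2-pos (κ j)))) (<⇒≤ (pow2-pos (κ j))) , ≤-refl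
    ... | true  = ≤-refl , ≤-trans (<⇒≤ (neg-antimono-< (pow2-pos (κ j)))) (<⇒≤ (pow2-pos (κ j)))

    Σ⟨⟩g-bounds : ∀ R (P : Fin n → Bool) → (∀ j → P j ≡ true → κ j ℕ.< R) →
                  - pow2 R < Σ⟨ P ⟩ g × Σ⟨ P ⟩ g < pow2 R
    Σ⟨⟩g-bounds R P bound =
      <-≤-trans (neg-antimono-< W<)
                (subst (_≤ Σ⟨ P ⟩ g) (Σall-neg (λ j → if P j then pow2 (κ j) else 0ℚ)) (Σall-mono-≤ lower)) ,
      ≤-<-trans (Σall-mono-≤ upper) W<
      where
      W< = Σ⟨⟩-pow2< κ κ-inj R P bound
      lower : ∀ j → - (if P j then pow2 (κ j) else 0ℚ) ≤ (if P j then g j else 0ℚ)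
      lower j with P j
      ... | true  = proj₁ (g-bounds j)
      ... | false = ≤-refl
      upper : ∀ j → (if P j then g j else 0ℚ) ≤ (if P j then pow2 (κ j) else 0ℚ)
      upper j with P j
      ... | true  = proj₂ (g-bounds j)
      ... | false = ≤-refl

    Σ⟨⟩h≡Σ⟨⟩g : ∀ (P : Fin n → Bool) → P i0 ≡ false → Σ⟨ P ⟩ h ≡ Σ⟨ P ⟩ g
    Σ⟨⟩h≡Σ⟨⟩g P Pi0 = Σ⟨⟩-cong P away-from-i0
      where
      away-from-i0 : ∀ j → P j ≡ true → h j ≡ g j
      away-from-i0 j Pj with j == i0 in j=i0
      ... | true  with () ← trans (sym Pi0) (trans (cong P (sym (==⇒≡ j i0 j=i0))) Pj)
      ... | false = refl

    -- The κ-largest element t of P outweighs all other elements of P together.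
    Σ⟨⟩h-sign : ∀ (P : Fin n → Bool) → P i0 ≡ false → ∀ w → P w ≡ true →
                let t = top κ i0 P in
                (negative t ≡ false → 0ℚ < Σ⟨ P ⟩ h) × (negative t ≡ true → Σ⟨ P ⟩ h < 0ℚ)
    Σ⟨⟩h-sign P Pi0 w Pw = positive-case , negative-case
      where
      t = top κ i0 P
      Pt×maximal = top-spec κ i0 P w Pw
      others : Fin n → Bool
      others j = P j ∧ not (j == t)
      rest = Σ⟨ others ⟩ g
      others<t : ∀ j → others j ≡ true → κ j ℕ.< κ t
      others<t j eq with P j in Pj | j == t in j=t
      ... | true | false = ℕₚ.≤∧≢⇒< (proj₂ Pt×maximal j Pj) λ κj≡κt →
        case trans (sym j=t) (subst (λ z → (j == z) ≡ true) (κ-inj j t κj≡κt) (==-refl j)) of λ ()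
      rest-bounds = Σ⟨⟩g-bounds (κ t) others others<t
      Σ≡ : Σ⟨ P ⟩ h ≡ g t + rest
      Σ≡ = trans (Σ⟨⟩h≡Σ⟨⟩g P Pi0) (Σ⟨⟩-extract P g t (proj₁ Pt×maximal))
      positive-case : negative t ≡ false → 0ℚ < Σ⟨ P ⟩ h
      positive-case neg-t rewrite Σ≡ | neg-t =
        subst (_< pow2 (κ t) + rest) (+-inverseʳ (pow2 (κ t))) (+-monoʳ-< (pow2 (κ t)) (proj₁ rest-bounds))
      negative-case : negative t ≡ true → Σ⟨ P ⟩ h < 0ℚ
      negative-case neg-t rewrite Σ≡ | neg-t =
        subst (- pow2 (κ t) + rest <_) (+-inverseˡ (pow2 (κ t))) (+-monoʳ-< (- pow2 (κ t)) (proj₂ rest-bounds))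

    Σ⟨⟩h≢0 : ∀ (P : Fin n → Bool) → P i0 ≡ false → ∀ w → P w ≡ true → Σ⟨ P ⟩ h ≢ 0ℚ
    Σ⟨⟩h≢0 P Pi0 w Pw Σ≡0 with negative (top κ i0 P) in neg-t
    ... | false = <⇒≢ (proj₁ (Σ⟨⟩h-sign P Pi0 w Pw) neg-t) (sym Σ≡0)
    ... | true  = <⇒≢ (proj₂ (Σ⟨⟩h-sign P Pi0 w Pw) neg-t) Σ≡0

module SignChambers where
  open import Data.Nat as ℕ using (ℕ; suc; _∸_)
  import Data.Nat.Properties as ℕₚ
  open import Data.Fin using (Fin)
  open import Data.Fin.Subset using (⊤; _∈_)
  open import Data.Bool using (Bool; true; false; if_then_else_; not)
  open import Data.Product using (Σ; _×_; _,_; proj₁; proj₂)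
  open import Data.Vec using (lookup; tabulate)
  open import Data.Vec.Properties using (lookup∘tabulate; lookup⇒[]=; []=⇒lookup; lookup-replicate)
  open import Data.Rational using (ℚ; 0ℚ; _+_; -_; _≤_; _<_)
  open import Data.Rational.Properties using (+-identityˡ; neg-antimono-<; <-irrefl; <-≤-trans; <⇒≤)
  open import Relation.Binary.PropositionalEquality
  open import Relation.Nullary using (¬_)
  open import Data.Empty using (⊥-elim)
  open import Function using (case_of_)
  open import Algebra.Properties.Group Data.Rational.Properties.+-0-group using (inverseˡ-unique)
  open BooleanTests
  open FinSum
  open CompositionBasics
  open ConeMembership using (inCone⇒atMost-nonneg; atMost-nonneg⇒inCone)
  open Dominance
  open BoundedQuantifiers

  ΣS-tabulate : ∀ {n} (P : Fin n → Bool) (f : Fin n → ℚ) → ΣS (tabulate P) f ≡ Σ⟨ P ⟩ f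
  ΣS-tabulate P f = trans (ΣS≡Σ⟨lookup⟩ (tabulate P) f)
                          (Σall-cong λ j → cong (λ b → if b then f j else 0ℚ) (lookup∘tabulate P j))

  ∈⊤ : ∀ {n} (x : Fin n) → x ∈ ⊤
  ∈⊤ x = lookup⇒[]= x ⊤ (lookup-replicate x true)

  module ChamberOfSigns {n} (i0 : Fin n) (κ : Fin n → ℕ) (κ-inj : ∀ a b → κ a ≡ κ b → a ≡ b)
                        (negative : Fin n → Bool) where
    open DominantPoint i0 κ κ-inj negative

    generic : ∀ S → ProperNonempty S → ¬ (ΣS S h ≡ 0ℚ)
    generic S ((x , x∈S) , (_ , (y , _ , y∉S))) ΣS≡0 with lookup S i0 in S∋i0
    ... | false = Σ⟨⟩h≢0 (lookup S) S∋i0 x ([]=⇒lookup x∈S) (trans (sym (ΣS≡Σ⟨lookup⟩ S h)) ΣS≡0)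
    ... | true  = Σ⟨⟩h≢0 (λ j → not (lookup S j)) (cong not S∋i0) y y∈∁S Σ∁S≡0
      where
      y∈∁S : not (lookup S y) ≡ true
      y∈∁S with lookup S y in Sy
      ... | true  = ⊥-elim (y∉S (lookup⇒[]= y S Sy))
      ... | false = refl
      Σ∁S≡0 : Σ⟨ (λ j → not (lookup S j)) ⟩ h ≡ 0ℚ
      Σ∁S≡0 = begin
        Σ⟨ (λ j → not (lookup S j)) ⟩ h                    ≡⟨ sym (+-identityˡ _) ⟩
        0ℚ + Σ⟨ (λ j → not (lookup S j)) ⟩ h
          ≡⟨ cong (_+ Σ⟨ (λ j → not (lookup S j)) ⟩ h) (trans (sym ΣS≡0) (ΣS≡Σ⟨lookup⟩ S h)) ⟩
        Σ⟨ lookup S ⟩ h + Σ⟨ (λ j → not (lookup S j)) ⟩ h  ≡⟨ Σ⟨⟩-complement (lookup S) h ⟩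
        Σall h                                             ≡⟨ Σh≡0 ⟩
        0ℚ                                                 ∎
        where open ≡-Reasoning

    chamberOfSigns : Chamber n
    chamberOfSigns = chamber h (Σh≡0 , generic)

    module _ (G : Composition n) (G∋i0 : FirstLumpContains i0 G) where
      k = Composition.k G

      tailTopsNegative : Bool
      tailTopsNegative = allBelow (k ∸ 1) (λ p → negative (top κ i0 (beyond G p)))

      atMost∋i0 : ∀ p → atMost G p i0 ≡ true
      atMost∋i0 p rewrite G∋i0 = refl

      beyond-nonempty : ∀ p → suc p ℕ.< k → Σ (Fin n) λ w → atMost G p w ≡ false
      beyond-nonempty p 1+p<k with lump-nonempty G (suc p) 1+p<k
      ... | w , ℓw≡1+p with atMost G p w in eq
      ...   | false = w , eq
      ...   | true  = ⊥-elim (ℕₚ.1+n≰n (subst (ℕ._≤ p) ℓw≡1+p (ℕₚ.≤ᵇ⇒≤ _ p (≡true⇒T eq))))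

      atMost-sign : ∀ p → suc p ℕ.< k →
        (negative (top κ i0 (beyond G p)) ≡ true  → 0ℚ < Σ⟨ atMost G p ⟩ h) ×
        (negative (top κ i0 (beyond G p)) ≡ false → Σ⟨ atMost G p ⟩ h < 0ℚ)
      atMost-sign p 1+p<k =
        (λ neg-t → subst (0ℚ <_) (sym Σ≡-Σbeyond) (neg-antimono-< (proj₂ sign neg-t))) ,
        (λ neg-t → subst (_< 0ℚ) (sym Σ≡-Σbeyond) (neg-antimono-< (proj₁ sign neg-t)))
        where
        w = proj₁ (beyond-nonempty p 1+p<k)
        sign = Σ⟨⟩h-sign (beyond G p) (cong not (atMost∋i0 p)) w (cong not (proj₂ (beyond-nonempty p 1+p<k)))
        Σ≡-Σbeyond : Σ⟨ atMost G p ⟩ h ≡ - Σ⟨ beyond G p ⟩ h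
        Σ≡-Σbeyond = inverseˡ-unique _ _ (trans (Σ⟨⟩-complement (atMost G p) h) Σh≡0)

      atMost-properNonempty : ∀ p → suc p ℕ.< k → ProperNonempty (tabulate (atMost G p))
      atMost-properNonempty p 1+p<k =
        (i0 , lookup⇒[]= i0 _ (trans (lookup∘tabulate (atMost G p) i0) (atMost∋i0 p))) ,
        (λ {x} _ → ∈⊤ x) ,
        (w , ∈⊤ w , λ w∈ → case trans (sym (proj₂ (beyond-nonempty p 1+p<k)))
                                      (trans (sym (lookup∘tabulate (atMost G p) w)) ([]=⇒lookup w∈)) of λ ())
        where w = proj₁ (beyond-nonempty p 1+p<k)

      chamber⊆cone : tailTopsNegative ≡ true → ChamberInCone chamberOfSigns G
      chamber⊆cone fits h' (generic' , sameSide) = atMost-nonneg⇒inCone G h' (proj₁ generic') prefix≥0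
        where
        prefix≥0 : ∀ p → suc p ℕ.< k → 0ℚ ≤ Σ⟨ atMost G p ⟩ h'
        prefix≥0 p 1+p<k = <⇒≤ (subst (0ℚ <_) (ΣS-tabulate (atMost G p) h')
          (proj₁ (sameSide (tabulate (atMost G p)) (atMost-properNonempty p 1+p<k))
                 (subst (0ℚ <_) (sym (ΣS-tabulate (atMost G p) h))
                        (proj₁ (atMost-sign p 1+p<k) (allBelow⁻ (k ∸ 1) _ fits p (suc<⇒<∸1 1+p<k))))))

      chamber⊈cone : tailTopsNegative ≡ false → ¬ ChamberInCone chamberOfSigns G
      chamber⊈cone misfit ⊆cone with allBelow-false (k ∸ 1) _ misfit
      ... | p , p<k-1 , positive-t =
        <-irrefl refl (<-≤-trans (proj₂ (atMost-sign p (<∸1⇒suc< p<k-1)) positive-t)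
                                 (inCone⇒atMost-nonneg G h (⊆cone h h∈C) p))
        where h∈C = (Σh≡0 , generic) , λ _ _ → (λ x → x) , (λ x → x)

module CutTops {n} (i0 : Fin n) (F : Composition n) where
  open import Data.Nat as ℕ using (ℕ; zero; suc; _∸_; _≤_; _<_; z≤n; s≤s)
  import Data.Nat.Properties as ℕₚ
  open import Data.Fin using (toℕ; combine; opposite)
  open import Data.Fin.Properties
    using (toℕ-injective; combine-injectiveʳ; combine-monoˡ-<; opposite-prop; toℕ<n; all?; ¬∀⟶∃¬)
  open import Data.Bool using (Bool; true; _∧_; not)
  open import Data.Bool.Properties using (∧-conicalˡ; ∧-conicalʳ)
  open import Data.Bool.ListAction using (all)
  open import Data.Product using (Σ; _,_; proj₁; proj₂)
  open import Data.Sum using (_⊎_; inj₁; inj₂)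
  open import Data.List using (List; map; downFrom)
  open import Data.Vec using (lookup)
  open import Relation.Binary.PropositionalEquality
  open import Relation.Nullary using (yes; no)
  open BooleanTests
  open CompositionBasics
  open Dominance using (top; top-spec)
  open BoundedQuantifiers
  open Rank
  open IncreasingSequences

  kF = Composition.k F
  ℓF = lumpOf F

  lumpIndex : Fin n → Fin kF
  lumpIndex j = opposite (lookup (Composition.lump F) j)

  κ : Fin n → ℕ
  κ j = toℕ (combine (lumpIndex j) j)

  κ-injective : ∀ a b → κ a ≡ κ b → a ≡ b
  κ-injective a b κa≡κb = combine-injectiveʳ (lumpIndex a) a (lumpIndex b) b (toℕ-injective κa≡κb)

  κ-antitone : ∀ a b → ℓF a < ℓF b → κ b < κ a
  κ-antitone a b ℓa<ℓb = combine-monoˡ-< b a (begin-strict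
    toℕ (lumpIndex b) ≡⟨ opposite-prop _ ⟩
    kF ∸ suc (ℓF b)   <⟨ ℕₚ.∸-monoʳ-< (s≤s ℓa<ℓb) (toℕ<n _) ⟩
    kF ∸ suc (ℓF a)   ≡⟨ opposite-prop _ ⟨
    toℕ (lumpIndex a) ∎)
    where open ℕₚ.≤-Reasoning

  cutTop : Composition n → ℕ → Fin n
  cutTop G p = top κ i0 (beyond G p)

  cutTop-spec : ∀ G p → suc p < Composition.k G →
                beyond G p (cutTop G p) ≡ true × (∀ j → beyond G p j ≡ true → ℓF (cutTop G p) ≤ ℓF j)
  cutTop-spec G p 1+p<k =
    proj₁ spec , λ j j∈ → ℕₚ.≮⇒≥ λ ℓj<ℓt → ℕₚ.<⇒≱ (κ-antitone j _ ℓj<ℓt) (proj₂ spec j j∈)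
    where
    w = proj₁ (lump-nonempty G (suc p) 1+p<k)
    w∈ = <⇒beyond G p w (ℕₚ.≤-reflexive (sym (proj₂ (lump-nonempty G (suc p) 1+p<k))))
    spec = top-spec κ i0 (beyond G p) w w∈

  isCutTop : Composition n → Fin n → Bool
  isCutTop G d = anyBelow (Composition.k G ∸ 1) (λ p → cutTop G p == d)

  cutTopsIn : Composition n → (Fin n → Bool) → Bool
  cutTopsIn G P = allBelow (Composition.k G ∸ 1) (λ p → P (cutTop G p))

  sameCutTops : Composition n → Bool
  sameCutTops G = cutTopsIn F (isCutTop G) ∧ cutTopsIn G (isCutTop F)

  cutTopList : List (Fin n)
  cutTopList = map (cutTop F) (downFrom (kF ∸ 1))

  cutTopsIn-F≡all : ∀ G → cutTopsIn F (isCutTop G) ≡ all (isCutTop G) cutTopList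
  cutTopsIn-F≡all G = sym (all-map-downFrom (kF ∸ 1) (cutTop F) (isCutTop G))

  cutTopsIn-remove : ∀ G P d → cutTopsIn G (λ e → P e ∧ not (e == d)) ≡ not (isCutTop G d) ∧ cutTopsIn G P
  cutTopsIn-remove G P d = allBelow-∧-not (Composition.k G ∸ 1) (λ p → P (cutTop G p)) (λ p → cutTop G p == d)

  sameCutTops-refl : sameCutTops F ≡ true
  sameCutTops-refl = cong₂ _∧_ F⊆F F⊆F
    where F⊆F = allBelow⁺ (kF ∸ 1) _ (λ p p<k → anyBelow⁺ (kF ∸ 1) _ p p<k (==-refl (cutTop F p)))

  ℓF-cutTopF : ∀ q → suc q < kF → ℓF (cutTop F q) ≡ suc q
  ℓF-cutTopF q 1+q<k = ℕₚ.≤-antisym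
    (ℕₚ.≤-trans (proj₂ (cutTop-spec F q 1+q<k) w (<⇒beyond F q w (ℕₚ.≤-reflexive (sym ℓw≡1+q))))
                (ℕₚ.≤-reflexive ℓw≡1+q))
    (beyond⇒< F q _ (proj₁ (cutTop-spec F q 1+q<k)))
    where
    w = proj₁ (lump-nonempty F (suc q) 1+q<k)
    ℓw≡1+q = proj₂ (lump-nonempty F (suc q) 1+q<k)

  module SameCutTops (G : Composition n) (F⊆G : cutTopsIn F (isCutTop G) ≡ true)
           (G⊆F : cutTopsIn G (isCutTop F) ≡ true) where
    kG = Composition.k G
    ℓG = lumpOf G
    τ = cutTop F

    cutTopF∈G : ∀ q → suc q < kF → Σ ℕ λ p → suc p < kG × cutTop G p ≡ τ q
    cutTopF∈G q 1+q<kF with anyBelow⁻ (kG ∸ 1) _ (allBelow⁻ (kF ∸ 1) _ F⊆G q (suc<⇒<∸1 1+q<kF))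
    ... | p , p<kG-1 , top≡ = p , <∸1⇒suc< p<kG-1 , ==⇒≡ _ _ top≡

    cutTopG∈F : ∀ p → suc p < kG → Σ ℕ λ q → suc q < kF × τ q ≡ cutTop G p
    cutTopG∈F p 1+p<kG with anyBelow⁻ (kF ∸ 1) _ (allBelow⁻ (kG ∸ 1) _ G⊆F p (suc<⇒<∸1 1+p<kG))
    ... | q , q<kF-1 , τq=t = q , <∸1⇒suc< q<kF-1 , ==⇒≡ _ _ τq=t

    ℓG∘τ-positive : ∀ q → suc q < kF → 0 < ℓG (τ q)
    ℓG∘τ-positive q 1+q<kF with cutTopF∈G q 1+q<kF
    ... | p , 1+p<kG , top≡ =
      ℕₚ.≤-<-trans z≤n (subst (λ d → p < ℓG d) top≡ (beyond⇒< G p _ (proj₁ (cutTop-spec G p 1+p<kG))))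

    ℓG∘τ-increasing : ∀ q → suc (suc q) < kF → ℓG (τ q) < ℓG (τ (suc q))
    ℓG∘τ-increasing q 2+q<kF with cutTopF∈G (suc q) 2+q<kF
    ... | p , 1+p<kG , top≡ = ℕₚ.≤-<-trans ℓτq≤p p<ℓτ
      where
      p<ℓτ : p < ℓG (τ (suc q))
      p<ℓτ = subst (λ d → p < ℓG d) top≡ (beyond⇒< G p _ (proj₁ (cutTop-spec G p 1+p<kG)))
      ℓτq≤p : ℓG (τ q) ≤ p
      ℓτq≤p = ℕₚ.≮⇒≥ λ p<ℓτq → ℕₚ.1+n≰n (begin
        suc (suc q)     ≡⟨ ℓF-cutTopF (suc q) 2+q<kF ⟨
        ℓF (τ (suc q))  ≡⟨ cong ℓF top≡ ⟨
        ℓF (cutTop G p) ≤⟨ proj₂ (cutTop-spec G p 1+p<kG) (τ q) (<⇒beyond G p (τ q) p<ℓτq) ⟩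
        ℓF (τ q)        ≡⟨ ℓF-cutTopF q (ℕₚ.<-trans (ℕₚ.n<1+n _) 2+q<kF) ⟩
        suc q           ∎)
        where open ℕₚ.≤-Reasoning

    ℓG∘τ-lower : ∀ q → suc q < kF → suc q ≤ ℓG (τ q)
    ℓG∘τ-lower = increasing⇒index≤ kF (λ q → ℓG (τ q)) ℓG∘τ-increasing
                   (ℓG∘τ-positive 0)

    kF≤kG : kF ≤ kG
    kF≤kG = bound kF refl
      where
      bound : ∀ m → kF ≡ m → m ≤ kG
      bound zero          _     = z≤n
      bound (suc zero)    _     = ℕₚ.≤-<-trans z≤n (lumpOf<k G i0)
      bound (suc (suc m)) kF≡m =
        ℕₚ.≤-<-trans (ℓG∘τ-lower m (subst (suc m <_) (sym kF≡m) ℕₚ.≤-refl)) (lumpOf<k G (τ m))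

    module _ (kG≡kF : kG ≡ kF) where
      ℓG∘τ-upper : ∀ q → suc q < kF → ℓG (τ q) ≤ suc q
      ℓG∘τ-upper = increasing⇒≤index kF (λ q → ℓG (τ q)) ℓG∘τ-increasing
                     (λ q _ → subst (ℓG (τ q) <_) kG≡kF (lumpOf<k G (τ q)))

      ℓG≤ℓF : ∀ j → ℓG j ≤ ℓF j
      ℓG≤ℓF j with ℓG j in ℓGj≡
      ... | zero  = z≤n
      ... | suc g = begin
        suc g           ≤⟨ beyond⇒< G g t (proj₁ (cutTop-spec G g 1+g<kG)) ⟩
        ℓG t            ≡⟨ cong ℓG τq≡t ⟨
        ℓG (τ q)        ≤⟨ ℓG∘τ-upper q 1+q<kF ⟩
        suc q           ≡⟨ ℓF-cutTopF q 1+q<kF ⟨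
        ℓF (τ q)        ≡⟨ cong ℓF τq≡t ⟩
        ℓF t            ≤⟨ proj₂ (cutTop-spec G g 1+g<kG) j j∈ ⟩
        ℓF j            ∎
        where
        open ℕₚ.≤-Reasoning
        t = cutTop G g
        1+g<kG = subst (_< kG) ℓGj≡ (lumpOf<k G j)
        q = proj₁ (cutTopG∈F g 1+g<kG)
        1+q<kF = proj₁ (proj₂ (cutTopG∈F g 1+g<kG))
        τq≡t = proj₂ (proj₂ (cutTopG∈F g 1+g<kG))
        j∈ = <⇒beyond G g j (subst (g <_) (sym ℓGj≡) ℕₚ.≤-refl)

    SameComp⊎rank< : SameComp G F ⊎ rank G < rank F
    SameComp⊎rank< with ℕₚ.m≤n⇒m<n∨m≡n kF≤kG
    ... | inj₁ kF<kG = inj₂ (rank-<-lumpCount G F kF<kG)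
    ... | inj₂ kF≡kG with all? (λ j → ℓG j ℕ.≟ ℓF j)
    ...   | yes ℓG≗ℓF = inj₁ (sameLumps⇒SameComp G F (sym kF≡kG) ℓG≗ℓF)
    ...   | no  ℓG≢ℓF with ¬∀⟶∃¬ n _ (λ j → ℓG j ℕ.≟ ℓF j) ℓG≢ℓF
    ...     | j , ℓGj≢ℓFj = inj₂ (rank-<-lumpOf G F (sym kF≡kG)
                (sumℕ-mono-< ℓG≤ℓF′ j (ℕₚ.≤∧≢⇒< (ℓG≤ℓF′ j) ℓGj≢ℓFj)))
      where ℓG≤ℓF′ = ℓG≤ℓF (sym kF≡kG)

  sameCutTops⇒SameComp⊎rank< : ∀ G → sameCutTops G ≡ true → SameComp G F ⊎ rank G < rank F
  sameCutTops⇒SameComp⊎rank< G same = SameCutTops.SameComp⊎rank< G (∧-conicalˡ _ _ same) (∧-conicalʳ _ _ same)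

module SelectedSums {c ℓ} (M : CommutativeMonoid c ℓ) {A : Set} where
  open CommutativeMonoid M renaming (Carrier to R)
  open import Data.Bool using (Bool; true; false; if_then_else_; _∧_; not)
  open import Data.Bool.Properties using (∧-assoc; ∧-zeroʳ)
  open import Data.Product using (_×_; _,_; proj₁)
  open import Data.Sum using (_⊎_; inj₁; inj₂)
  open import Data.List using (List; []; _∷_)
  open import Data.Bool.ListAction using (all)
  open import Data.List.Membership.Propositional using (_∈_)
  open import Data.List.Relation.Unary.Any using (here; there)
  open import Data.List.Relation.Unary.All as All using (All)
  open import Data.List.Relation.Unary.AllPairs using (AllPairs; _∷_)
  open import Relation.Binary.PropositionalEquality as ≡ using (_≡_)
  open import Relation.Nullary using (¬_)
  open import Data.Empty using (⊥-elim)
  open import Algebra.Properties.CommutativeSemigroup commutativeSemigroup using (interchange)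

  sumWhere : (A → Bool) → List (A × R) → R
  sumWhere φ []            = ε
  sumWhere φ ((x , a) ∷ L) = (if φ x then a else ε) ∙ sumWhere φ L

  sumWhere-cong : ∀ {φ ψ} L → (∀ x → φ x ≡ ψ x) → sumWhere φ L ≈ sumWhere ψ L
  sumWhere-cong []            φ≗ψ = refl
  sumWhere-cong ((x , a) ∷ L) φ≗ψ rewrite φ≗ψ x = ∙-congˡ (sumWhere-cong L φ≗ψ)

  sumWhere-split : ∀ (m φ : A → Bool) L →
    sumWhere φ L ≈ sumWhere (λ x → m x ∧ φ x) L ∙ sumWhere (λ x → not (m x) ∧ φ x) L
  sumWhere-split m φ []            = sym (identityʳ ε)
  sumWhere-split m φ ((x , a) ∷ L) =
    trans (∙-cong (split (m x) (φ x)) (sumWhere-split m φ L)) (interchange _ _ _ _)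
    where
    split : ∀ b b′ → (if b′ then a else ε) ≈ (if b ∧ b′ then a else ε) ∙ (if not b ∧ b′ then a else ε)
    split true  true  = sym (identityʳ a)
    split true  false = sym (identityʳ ε)
    split false true  = sym (identityˡ a)
    split false false = sym (identityʳ ε)

  sumWhere-≈ε : ∀ φ L → (∀ {x a} → (x , a) ∈ L → φ x ≡ true → a ≈ ε) → sumWhere φ L ≈ ε
  sumWhere-≈ε φ []            _      = refl
  sumWhere-≈ε φ ((x , a) ∷ L) vanish =
    trans (∙-cong selected (sumWhere-≈ε φ L (λ x∈L → vanish (there x∈L)))) (identityʳ ε)
    where
    selected : (if φ x then a else ε) ≈ ε
    selected with φ x in φx
    ... | true  = vanish (here ≡.refl) φx
    ... | false = refl

  -- Inclusion–exclusion: if every "sub x P" sums to zero, so does every sum that additionally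
  -- requires the elements of ds, because requiring d is "sub x P" minus "sub x (P ∖ {d})".
  module InclusionExclusion {D : Set} (mem : A → D → Bool) (sub : A → (D → Bool) → Bool)
    (_≟ᵇ_ : D → D → Bool)
    (sub-remove : ∀ x P d → sub x (λ e → P e ∧ not (e ≟ᵇ d)) ≡ not (mem x d) ∧ sub x P)
    (L : List (A × R)) (vanishing : ∀ P → sumWhere (λ x → sub x P) L ≈ ε) where

    requiring-vanishes : ∀ ds P → sumWhere (λ x → all (mem x) ds ∧ sub x P) L ≈ ε
    requiring-vanishes []       P = vanishing P
    requiring-vanishes (d ∷ ds) P = begin
      sumWhere requiring L                                    ≈⟨ identityʳ _ ⟨
      sumWhere requiring L ∙ ε                                ≈⟨ ∙-congˡ removed ⟨
      sumWhere requiring L ∙ sumWhere (λ x → not (mem x d) ∧ ψ x) L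
        ≈⟨ ∙-congʳ (sumWhere-cong L (λ x → ∧-assoc (mem x d) _ _)) ⟩
      sumWhere (λ x → mem x d ∧ ψ x) L ∙ sumWhere (λ x → not (mem x d) ∧ ψ x) L
        ≈⟨ sumWhere-split (λ x → mem x d) ψ L ⟨
      sumWhere ψ L                                            ≈⟨ requiring-vanishes ds P ⟩
      ε                                                       ∎
      where
      open import Relation.Binary.Reasoning.Setoid setoid
      ψ = λ x → all (mem x) ds ∧ sub x P
      requiring = λ x → all (mem x) (d ∷ ds) ∧ sub x P
      reorder : ∀ b a s s′ → s′ ≡ not b ∧ s → not b ∧ (a ∧ s) ≡ a ∧ s′
      reorder true  a s s′ ≡.refl = ≡.sym (∧-zeroʳ a)
      reorder false a s s′ ≡.refl = ≡.refl
      removed : sumWhere (λ x → not (mem x d) ∧ ψ x) L ≈ ε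
      removed = trans (sumWhere-cong L (λ x → reorder (mem x d) _ _ _ (sub-remove x P d)))
                      (requiring-vanishes ds (λ e → P e ∧ not (e ≟ᵇ d)))

  module _ {_~_ : A → A → Set} (~-sym : ∀ {x y} → x ~ y → y ~ x) where
    sumWhere-single : ∀ φ x a L → AllPairs (λ p q → ¬ (proj₁ p ~ proj₁ q)) L → (x , a) ∈ L → φ x ≡ true →
      (∀ {y b} → (y , b) ∈ L → φ y ≡ true → y ~ x ⊎ b ≈ ε) → sumWhere φ L ≈ a
    sumWhere-single φ x a (_ ∷ L) (x≁L ∷ _) (here ≡.refl) φx others rewrite φx =
      trans (∙-congˡ (sumWhere-≈ε φ L vanish)) (identityʳ a)
      where
      vanish : ∀ {y b} → (y , b) ∈ L → φ y ≡ true → b ≈ ε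
      vanish y∈L φy with others (there y∈L) φy
      ... | inj₁ y~x = ⊥-elim (All.lookup x≁L y∈L (~-sym y~x))
      ... | inj₂ b≈ε = b≈ε
    sumWhere-single φ x a ((y , b) ∷ L) (y≁L ∷ distinct) (there x∈L) φx others =
      trans (∙-cong head≈ε (sumWhere-single φ x a L distinct x∈L φx (λ z∈L → others (there z∈L))))
            (identityˡ a)
      where
      head≈ε : (if φ y then b else ε) ≈ ε
      head≈ε with φ y in φy
      ... | false = refl
      ... | true with others (here ≡.refl) φy
      ...   | inj₁ y~x = ⊥-elim (All.lookup y≁L x∈L y~x)
      ...   | inj₂ b≈ε = b≈ε

module Independence {c ℓ} (K : CharZeroField c ℓ) {n : ℕ} (i0 : Fin n)
  (cc : Composition n → Chamber n → CharZeroField.Carrier K) (isC : IsCheckC K cc)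
  (L : List (Composition n × CharZeroField.Carrier K))
  (L⊆Σi0 : All (λ p → FirstLumpContains i0 (proj₁ p)) L)
  (distinct : AllPairs (λ p q → ¬ SameComp (proj₁ p) (proj₁ q)) L)
  (relation : ∀ C → CharZeroField._≈_ K (linComb K cc L C) (CharZeroField.0# K)) where
  open CharZeroField K
  open import Data.Nat using (_<_)
  open import Data.Nat.Induction using (<-rec)
  open import Data.Bool using (Bool; true; false; if_then_else_; _∧_)
  open import Data.Product using (_,_)
  open import Data.Sum using (_⊎_; inj₁; inj₂)
  open import Data.List using ([]; _∷_)
  open import Data.List.Membership.Propositional using (_∈_)
  open import Data.List.Relation.Unary.Any using (here; there)
  open import Relation.Binary.PropositionalEquality as ≡ using (_≡_)
  open BooleanTests using (_==_)
  open SignChambers using (module ChamberOfSigns)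
  open SelectedSums +-commutativeMonoid {Composition n}
  open Rank using (rank)
  open CompositionBasics using (SameComp-sym)

  linComb≈sumWhere : ∀ C (φ : Composition n → Bool) L′ →
    (∀ {G a} → (G , a) ∈ L′ → cc G C ≈ (if φ G then 1# else 0#)) → linComb K cc L′ C ≈ sumWhere φ L′
  linComb≈sumWhere C φ []            _      = refl
  linComb≈sumWhere C φ ((G , a) ∷ L′) values =
    +-cong (trans (*-congˡ (values (here ≡.refl))) (scale (φ G)))
           (linComb≈sumWhere C φ L′ (λ m → values (there m)))
    where
    scale : ∀ b → a * (if b then 1# else 0#) ≈ (if b then a else 0#)
    scale true  = *-identityʳ a
    scale false = zeroʳ a

  module _ (F : Composition n) where
    open CutTops i0 F

    cutTopsIn-vanishes : ∀ P → sumWhere (λ G → cutTopsIn G P) L ≈ 0#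
    cutTopsIn-vanishes P = trans (sym (linComb≈sumWhere C _ L values)) (relation C)
      where
      open ChamberOfSigns i0 κ κ-injective P
      C = chamberOfSigns
      values : ∀ {G a} → (G , a) ∈ L → cc G C ≈ (if cutTopsIn G P then 1# else 0#)
      values {G} G∈L with cutTopsIn G P in tops∈P
      ... | true  = proj₁ (isC G C) (chamber⊆cone G (All.lookup L⊆Σi0 G∈L) tops∈P)
      ... | false = proj₂ (isC G C) (chamber⊈cone G (All.lookup L⊆Σi0 G∈L) tops∈P)

    sameCutTops-vanishes : sumWhere sameCutTops L ≈ 0#
    sameCutTops-vanishes =
      trans (sumWhere-cong L (λ G → ≡.cong (_∧ cutTopsIn G (isCutTop F)) (cutTopsIn-F≡all G)))
            (requiring-vanishes cutTopList (isCutTop F))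
      where open InclusionExclusion isCutTop cutTopsIn _==_ cutTopsIn-remove L cutTopsIn-vanishes

  coefficient-vanishes : ∀ {F a} → (F , a) ∈ L → a ≈ 0#
  coefficient-vanishes {F} F∈L = <-rec Claim step (rank F) F∈L ≡.refl
    where
    Claim = λ r → ∀ {F a} → (F , a) ∈ L → rank F ≡ r → a ≈ 0#
    step : ∀ r → (∀ {r′} → r′ < r → Claim r′) → Claim r
    step r ih {F} {a} F∈L ≡.refl =
      trans (sym (sumWhere-single SameComp-sym sameCutTops F a L distinct F∈L sameCutTops-refl smaller))
            (sameCutTops-vanishes F)
      where
      open CutTops i0 F using (sameCutTops; sameCutTops-refl; sameCutTops⇒SameComp⊎rank<)
      smaller : ∀ {G b} → (G , b) ∈ L → sameCutTops G ≡ true → SameComp G F ⊎ b ≈ 0#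
      smaller G∈L same with sameCutTops⇒SameComp⊎rank< _ same
      ... | inj₁ G≅F = inj₁ G≅F
      ... | inj₂ G<F = inj₂ (ih G<F G∈L ≡.refl)

mainTheorem12 : ∀ {c ℓ} (K : CharZeroField c ℓ) (n : ℕ) (i0 : Fin n)
    (cc : Composition n → Chamber n → CharZeroField.Carrier K) →
    IsCheckC K cc →
    (L : List (Composition n × CharZeroField.Carrier K)) →
    All (λ p → FirstLumpContains i0 (proj₁ p)) L →
    AllPairs (λ p q → ¬ SameComp (proj₁ p) (proj₁ q)) L →
    (∀ (C : Chamber n) → CharZeroField._≈_ K (linComb K cc L C) (CharZeroField.0# K)) →
    All (λ p → CharZeroField._≈_ K (proj₂ p) (CharZeroField.0# K)) L
mainTheorem12 K n i0 cc isC L L⊆Σi0 distinct relation =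
  All.tabulate (Independence.coefficient-vanishes K i0 cc isC L L⊆Σi0 distinct relation)
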